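{- Define elements $\mathbf R_\pi$ of $\mathrm{CQSym}$ (for $\pi$ a nondecreasing parking function) by the triangular relations $\mathbf P^\pi=\sum_{\pi'\succeq\pi}\mathbf R_{\pi'}$. Then for nonempty nondecreasing parking functions $\pi',\pi''$, $$\mathbf R_{\pi'}\mathbf R_{\pi''}=\mathbf R_{\pi'\bullet\pi''}+\mathbf R_{\pi'\triangleright\pi''},$$ where $\pi'\triangleright\pi''$ is obtained from $\pi'\bullet\pi''$ by replacing every occurrence of the smallest letter of the shifted copy of $\pi''$ (namely $|\pi'|+1$) by the greatest letter of $\pi'$.
   Context: Words are finite sequences of positive integers. For $|u|=k$, $u\bullet v=u\cdot v[k]$ and $u\Cup v$ is the shuffle of $u$ with $v[k]$, where $v[k]$ is $v$ with $k$ added to each letter. A parking function of length $n$ is a word over $\{1,\dots,n\}$ whose nondecreasing rearrangement $a'_1\le\dots\le a'_n$ satisfies $a'_i\le i$. $\mathrm{PQSym}$ is the algebra with basis $(\mathbf F_{\mathbf a})$ indexed by parking functions and product $\mathbf F_{\mathbf a'}\mathbf F_{\mathbf a''}=\sum_{\mathbf a\in\mathbf a'\Cup\mathbf a''}\mathbf F_{\mathbf a}$. For a nondecreasing parking function $\pi$, $\mathbf P^\pi=\sum\mathbf F_{\mathbf a}$ over parking functions $\mathbf a$ with nondecreasing rearrangement $\pi$; $\mathrm{CQSym}$ is their span (a subalgebra with $\mathbf P^{\pi'}\mathbf P^{\pi''}=\mathbf P^{\pi'\bullet\pi''}$). The evaluation vector of a nondecreasing parking function $\pi$ of length $n$ is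 $(m_1,\dots,m_n)$, $m_i$ the number of occurrences of $i$. A successor of $\pi$ is a nondecreasing parking function whose evaluation vector is obtained from that of $\pi$ by choosing two nonzero entries with only zero entries between them, replacing the left one by their sum and the right one by $0$ (e.g. the successors of $113346$ are $111146,113336,113344$). $\succeq$ is the reflexive transitive closure: $\pi'\succeq\pi$ iff $\pi'$ is obtained from $\pi$ by successive applications of the successor operation. -}

module Defs where

open import Data.Bool using (Bool; true; false; if_then_else_; _∧_; T)
open import Data.Nat using (ℕ; zero; suc; _+_; _∸_; _≤_; _<ᵇ_; _≤ᵇ_; _≡ᵇ_; _⊔_)
open import Data.Nat.Properties using (≤-decTotalOrder)
open import Data.Integer using (ℤ) renaming (_+_ to _+ℤ_; _*_ to _*ℤ_; 0ℤ to 0ℤ; 1ℤ to 1ℤ)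
open import Data.List using (List; []; _∷_; _++_; map; length; concatMap; replicate; foldr; deduplicate; filter)
open import Data.List.Properties using (≡-dec)
open import Data.List.Relation.Unary.Linked using (Linked)
open import Data.Product using (_×_; _,_)
open import Relation.Nullary using (Dec; yes; no)
open import Relation.Binary.PropositionalEquality using (_≡_)
import Data.Nat as ℕ
open import Data.List.Sort ≤-decTotalOrder using (sort) public

-- Words are lists of natural numbers (letters are meant to be positive).
Word : Set
Word = List ℕ

_≟w_ : (u v : Word) → Dec (u ≡ v)
_≟w_ = ≡-dec ℕ._≟_

eqW : Word → Word → Bool
eqW u v with u ≟w v
... | yes _ = true
... | no  _ = false

checkPark : ℕ → Word → Bool
checkPark i [] = true
checkPark i (x ∷ xs) = (1 ≤ᵇ x) ∧ (x ≤ᵇ i) ∧ checkPark (suc i) xs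

IsParking : Word → Set
IsParking a = T (checkPark 1 (sort a))

NDPF : Word → Set
NDPF π = Linked _≤_ π × IsParking π

shift : ℕ → Word → Word
shift k = map (k +_)

_•_ : Word → Word → Word
u • v = u ++ shift (length u) v

maxLetter : Word → ℕ
maxLetter = foldr _⊔_ 0

_▷_ : Word → Word → Word
u ▷ v = u ++ map (λ x → if x ≡ᵇ suc (length u) then maxLetter u else x) (shift (length u) v)

-- PQSym: an element is given by its coefficient function a ↦ coeff of F_a

PQ : Set
PQ = Word → ℤ

splits : Word → List (Word × Word)
splits [] = ( [] , [] ) ∷ []
splits (x ∷ xs) = concatMap (λ { (u , v) → (x ∷ u , v) ∷ (u , x ∷ v) ∷ [] }) (splits xs)

allB : (ℕ → Bool) → Word → Bool
allB p [] = true
allB p (x ∷ xs) = p x ∧ allB p xs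

sumℤ : List ℤ → ℤ
sumℤ = foldr _+ℤ_ 0ℤ

-- product of PQSym: F_{a'} F_{a''} = Σ_{a ∈ a' ⋓ a''} F_a, extended bilinearly.
-- Coefficient of F_a is the sum over position sets S of f(a|_S) g(a|_{S^c} - |S|),
-- where the complement letters must all exceed |S|.
splitTerm : PQ → PQ → Word × Word → ℤ
splitTerm f g (u , v) =
  if allB (λ x → length u <ᵇ x) v
  then f u *ℤ g (map (λ x → x ∸ length u) v)
  else 0ℤ

_⊛_ : PQ → PQ → PQ
(f ⊛ g) a = sumℤ (map (splitTerm f g) (splits a))

-- P^π = Σ F_a over a with nondecreasing rearrangement π
P : Word → PQ
P π a = if eqW (sort a) π then 1ℤ else 0ℤ

count : ℕ → Word → ℕ
count i [] = 0
count i (x ∷ xs) = (if x ≡ᵇ i then 1 else 0) + count i xs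

evFrom : ℕ → ℕ → Word → List ℕ
evFrom i zero π = []
evFrom i (suc k) π = count i π ∷ evFrom (suc i) k π

ev : Word → List ℕ
ev π = evFrom 1 (length π) π

fromEvFrom : ℕ → List ℕ → Word
fromEvFrom i [] = []
fromEvFrom i (m ∷ ms) = replicate m i ++ fromEvFrom (suc i) ms

fromEv : List ℕ → Word
fromEv = fromEvFrom 1

mergeNext : ℕ → ℕ → List ℕ → List (List ℕ)
mergeNext a z [] = []
mergeNext a z (zero ∷ l) = mergeNext a (suc z) l
mergeNext a z (suc b ∷ l) = ((a + suc b) ∷ replicate z 0 ++ 0 ∷ l) ∷ []

succEv : List ℕ → List (List ℕ)
succEv [] = []
succEv (zero ∷ l) = map (zero ∷_) (succEv l)
succEv (suc a ∷ l) = mergeNext (suc a) 0 l ++ map (suc a ∷_) (succEv l)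

successors : Word → List Word
successors π = map fromEv (succEv (ev π))

upIter : ℕ → Word → List Word
upIter zero π = π ∷ []
upIter (suc k) π = deduplicate _≟w_ (upIter k π ++ concatMap successors (upIter k π))

-- each successor step lowers the number of nonzero entries of the evaluation
-- vector, so |π| iterations reach the full reflexive–transitive closure
upSet : Word → List Word
upSet π = upIter (length π) π

sumUp : (Word → PQ) → Word → PQ
sumUp R π a = sumℤ (map (λ π' → R π' a) (upSet π))

module Submission where

-- A successor of π deletes one of its letters other than 1 (every occurrence becomes the
-- next smaller letter of π), so the π' ⪰ π are exactly the lowerings of π to the letter sets
-- {1} ∪ S, S a set of other letters of π, and the triangular relations are inverted by the
-- Möbius function of this Boolean lattice: the coefficient of F_a in R_π is
-- (-1)^(number of letters of π missing from σ) if σ = sort a satisfies σ ⪰ π, and 0 otherwise.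
-- In the product R_π' R_π'' only the split of a into its letters ≤ |π'| and > |π'| can
-- contribute; when σ contains |π'| + 1 the product is the coefficient of R_{π' • π''}, and
-- π' ▷ π'' is π' • π'' with the letter |π'| + 1 deleted, whose coefficient is 0 in that case
-- and cancels the one of π' • π'' otherwise.

open import Defs
open import Data.Bool using (Bool; true; false; if_then_else_; _∧_; _∨_; not; T)
import Data.Bool.Properties as BP
open import Data.Empty using (⊥; ⊥-elim)
open import Data.Unit using (tt)
open import Data.Nat using (ℕ; zero; suc; _+_; _∸_; _≤_; _<_; _<ᵇ_; _≤ᵇ_; _≡ᵇ_; z≤n; s≤s; z<s; _≟_; _≤?_)
open import Data.Nat.Properties
open import Data.Nat.Induction using (<-rec)
open import Data.Nat.ListAction using (sum)
open import Data.Integer using (ℤ; -_) renaming (_+_ to _+ℤ_; _*_ to _*ℤ_; 0ℤ to 0ℤ; 1ℤ to 1ℤ)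
import Data.Integer.Properties as ℤP
open import Data.List using (List; []; _∷_; _++_; map; length; concatMap; replicate; deduplicate; filter; filterᵇ)
open import Data.List.Properties using (map-++; ++-assoc; ++-identityʳ; map-∘; map-cong-local; map-id-local; map-replicate; map-injective; ∷-injective; length-map; length-filter; length-deduplicate; filter-++; filter-all; filter-none; filter-accept; filter-reject)
open import Data.List.Membership.Propositional using (_∈_; find; lose)
open import Data.List.Membership.Propositional.Properties using (∈-map⁺; ∈-map⁻; ∈-++⁺ˡ; ∈-++⁺ʳ; ∈-++⁻; ∈-concatMap⁺; ∈-concatMap⁻; ∈-deduplicate⁻; ∈-deduplicate⁺; ∈-filter⁻)
open import Data.List.Membership.Propositional.Properties.WithK using (unique∧set⇒bag)
open import Data.List.Relation.Binary.BagAndSetEquality using (∼bag⇒↭)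
open import Data.List.Relation.Binary.Permutation.Propositional using (_↭_; ↭⇒↭ₛ; prep; ↭-trans; ↭-sym; ↭-refl)
import Data.List.Relation.Binary.Permutation.Propositional.Properties as PP
open import Data.List.Relation.Binary.Permutation.Propositional.Properties using (filter-↭; ↭-length)
open import Data.List.Relation.Binary.Pointwise using (Pointwise-≡⇒≡)
open import Data.List.Relation.Unary.All using (All; []; _∷_)
import Data.List.Relation.Unary.All as All
import Data.List.Relation.Unary.All.Properties as AllP
open import Data.List.Relation.Unary.AllPairs using (AllPairs; []; _∷_)
open import Data.List.Relation.Unary.Any using (here; there)
open import Data.List.Relation.Unary.Linked using (Linked; []; [-]; _∷_)
import Data.List.Relation.Unary.Linked as Linked
import Data.List.Relation.Unary.Linked.Properties as LP
import Data.List.Relation.Unary.AllPairs as AllPairs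
import Data.List.Relation.Unary.Sorted.TotalOrder.Properties as SP
open import Data.List.Relation.Unary.Unique.Propositional using (Unique)
import Data.List.Relation.Unary.Unique.Propositional.Properties as UP
open import Data.List.Relation.Unary.Unique.DecPropositional.Properties _≟_ using (deduplicate-!)
import Data.List.Relation.Unary.Unique.DecPropositional.Properties as UDP
open import Data.List.Sort ≤-decTotalOrder using (sort-↭; sort-↗)
open import Data.Product using (_×_; _,_; Σ; ∃; proj₁; proj₂)
open import Data.Sum using (_⊎_; inj₁; inj₂)
open import Function using (_∘_; id)
open import Function.Bundles using (mk⇔; Equivalence)
open import Relation.Binary.PropositionalEquality
import Data.List.Relation.Binary.Permutation.Setoid.Properties (setoid ℤ) as PermS
open import Relation.Nullary using (¬_; yes; no)
open import Relation.Nullary.Decidable using (T?; ¬?)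
open import Algebra.Bundles using (AbelianGroup)
import Algebra.Properties.Group (AbelianGroup.group ℤP.+-0-abelianGroup) as ℤGroup

≡ᵇ-refl : ∀ n → (n ≡ᵇ n) ≡ true
≡ᵇ-refl zero = refl
≡ᵇ-refl (suc n) = ≡ᵇ-refl n

≡ᵇ≡true⇒≡ : ∀ m n → (m ≡ᵇ n) ≡ true → m ≡ n
≡ᵇ≡true⇒≡ m n e = ≡ᵇ⇒≡ m n (subst T (sym e) tt)

≢⇒≡ᵇ≡false : ∀ m n → m ≢ n → (m ≡ᵇ n) ≡ false
≢⇒≡ᵇ≡false m n ne with m ≡ᵇ n in e
... | true = ⊥-elim (ne (≡ᵇ≡true⇒≡ m n e))
... | false = refl

≡ᵇ-sym : ∀ m n → (m ≡ᵇ n) ≡ (n ≡ᵇ m)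
≡ᵇ-sym zero zero = refl
≡ᵇ-sym zero (suc n) = refl
≡ᵇ-sym (suc m) zero = refl
≡ᵇ-sym (suc m) (suc n) = ≡ᵇ-sym m n

true≢false : true ≢ false
true≢false ()

T⇒≡true : ∀ {b} → T b → b ≡ true
T⇒≡true = Equivalence.to BP.T-≡

≡true⇒T : ∀ {b} → b ≡ true → T b
≡true⇒T = Equivalence.from BP.T-≡

¬T⇒≡false : ∀ {b} → ¬ T b → b ≡ false
¬T⇒≡false {false} _ = refl
¬T⇒≡false {true} h = ⊥-elim (h tt)

∧≡true⇒ˡ : ∀ {a b} → (a ∧ b) ≡ true → a ≡ true
∧≡true⇒ˡ {true} _ = refl

bool-ext : ∀ a b → (a ≡ true → b ≡ true) → (b ≡ true → a ≡ true) → a ≡ b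
bool-ext false false f g = refl
bool-ext false true f g = g refl
bool-ext true false f g = sym (f refl)
bool-ext true true f g = refl

mem : ℕ → Word → Bool
mem j [] = false
mem j (x ∷ xs) = (x ≡ᵇ j) ∨ mem j xs

mem-++ : ∀ j xs ys → mem j (xs ++ ys) ≡ (mem j xs ∨ mem j ys)
mem-++ j [] ys = refl
mem-++ j (x ∷ xs) ys rewrite mem-++ j xs ys = sym (BP.∨-assoc (x ≡ᵇ j) (mem j xs) (mem j ys))

mem→∈ : ∀ j xs → mem j xs ≡ true → j ∈ xs
mem→∈ j (x ∷ xs) e with x ≡ᵇ j in eq
... | true = here (sym (≡ᵇ≡true⇒≡ x j eq))
... | false = there (mem→∈ j xs e)

∈→mem : ∀ j xs → j ∈ xs → mem j xs ≡ true
∈→mem j (x ∷ xs) (here refl) rewrite ≡ᵇ-refl j = refl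
∈→mem j (x ∷ xs) (there p) rewrite ∈→mem j xs p = BP.∨-zeroʳ (x ≡ᵇ j)

∉→mem : ∀ j xs → ¬ (j ∈ xs) → mem j xs ≡ false
∉→mem j xs ne with mem j xs in eq
... | true = ⊥-elim (ne (mem→∈ j xs eq))
... | false = refl

mem-replicate-≢ : ∀ y c x → x ≢ y → mem y (replicate c x) ≡ false
mem-replicate-≢ y zero x ne = refl
mem-replicate-≢ y (suc c) x ne rewrite ≢⇒≡ᵇ≡false x y ne = mem-replicate-≢ y c x ne

mem-below : ∀ j y l → All (j ≤_) l → y < j → mem y l ≡ false
mem-below j y l a lt = ∉→mem y l (λ y∈ → <⇒≱ lt (All.lookup a y∈))

mem-above : ∀ k j l → All (_≤ k) l → k < j → mem j l ≡ false
mem-above k j l a lt = ∉→mem j l (λ j∈ → <⇒≱ lt (All.lookup a j∈))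

replicate-+ : ∀ m n (x : ℕ) → replicate (m + n) x ≡ replicate m x ++ replicate n x
replicate-+ zero n x = refl
replicate-+ (suc m) n x = cong (x ∷_) (replicate-+ m n x)

∈-replicate⇒≡ : ∀ c (x y : ℕ) → y ∈ replicate c x → y ≡ x
∈-replicate⇒≡ (suc c) x y (here e) = e
∈-replicate⇒≡ (suc c) x y (there p) = ∈-replicate⇒≡ c x y p

linked-all : ∀ x zs → Linked _≤_ (x ∷ zs) → All (x ≤_) zs
linked-all x zs l = AllPairs.head (LP.Linked⇒AllPairs ≤-trans l)

linked-map : ∀ (f : ℕ → ℕ) xs → (∀ x y → x ≤ y → f x ≤ f y) → Linked _≤_ xs → Linked _≤_ (map f xs)
linked-map f xs mono l = LP.map⁺ (Linked.map (λ {x} {y} → mono x y) l)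

linked-++ : ∀ xs ys → Linked _≤_ xs → Linked _≤_ ys → (∀ {x} → x ∈ xs → ∀ {y} → y ∈ ys → x ≤ y) → Linked _≤_ (xs ++ ys)
linked-++ [] ys lx ly h = ly
linked-++ (x ∷ []) [] lx ly h = [-]
linked-++ (x ∷ []) (y ∷ ys) lx ly h = h (here refl) (here refl) ∷ ly
linked-++ (x ∷ x' ∷ xs) ys (r ∷ lx) ly h = r ∷ linked-++ (x' ∷ xs) ys lx ly (λ p q → h (there p) q)

sort-unique : ∀ xs ys → Linked _≤_ ys → xs ↭ ys → sort xs ≡ ys
sort-unique xs ys ys↗ p = Pointwise-≡⇒≡ (SP.↗↭↗⇒≋ ≤-totalOrder (sort-↗ xs) ys↗ (↭⇒↭ₛ (↭-trans (sort-↭ xs) p)))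

sort-sorted : ∀ xs → Linked _≤_ xs → sort xs ≡ xs
sort-sorted xs s = sort-unique xs xs s ↭-refl

length-sort : ∀ u → length (sort u) ≡ length u
length-sort u = PP.↭-length (sort-↭ u)

∈-sort⁻ : ∀ u {x} → x ∈ sort u → x ∈ u
∈-sort⁻ u p = PP.∈-resp-↭ (sort-↭ u) p

∈-sort⁺ : ∀ u {x} → x ∈ u → x ∈ sort u
∈-sort⁺ u p = PP.∈-resp-↭ (↭-sym (sort-↭ u)) p

-- Lowering a word to a set of letters

floor : (ℕ → Bool) → ℕ → ℕ
floor P zero = zero
floor P (suc y) = if P (suc y) then suc y else floor P y

floor-≤ : ∀ (P : ℕ → Bool) y → floor P y ≤ y
floor-≤ P zero = z≤n
floor-≤ P (suc y) with P (suc y)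
... | true = ≤-refl
... | false = m≤n⇒m≤1+n (floor-≤ P y)

floor-cong : ∀ P Q → (∀ j → P j ≡ Q j) → ∀ y → floor P y ≡ floor Q y
floor-cong P Q e zero = refl
floor-cong P Q e (suc y) rewrite e (suc y) | floor-cong P Q e y = refl

floor-cong-≤ : ∀ (P Q : ℕ → Bool) y → (∀ j → j ≤ y → P j ≡ Q j) → floor P y ≡ floor Q y
floor-cong-≤ P Q zero h = refl
floor-cong-≤ P Q (suc y) h rewrite h (suc y) ≤-refl | floor-cong-≤ P Q y (λ j le → h j (m≤n⇒m≤1+n le)) = refl

floor-fixed : ∀ P y → P y ≡ true → floor P y ≡ y
floor-fixed P zero e = refl
floor-fixed P (suc y) e rewrite e = refl

floor-satisfies : ∀ (P : ℕ → Bool) (t y : ℕ) → P t ≡ true → t ≤ y → P (floor P y) ≡ true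
floor-satisfies P t zero e z≤n = e
floor-satisfies P t (suc y) e t≤ with P (suc y) in eq
... | true = eq
... | false with t ≟ suc y
... | yes refl = ⊥-elim (true≢false (trans (sym e) eq))
... | no ne = floor-satisfies P t y e (m<1+n⇒m≤n (≤∧≢⇒< t≤ ne))

floor-≥ : ∀ (P : ℕ → Bool) (t y : ℕ) → P t ≡ true → t ≤ y → t ≤ floor P y
floor-≥ P t zero e z≤n = z≤n
floor-≥ P t (suc y) e t≤ with P (suc y) in eq
... | true = t≤
... | false with t ≟ suc y
... | yes refl = ⊥-elim (true≢false (trans (sym e) eq))
... | no ne = floor-≥ P t y e (m<1+n⇒m≤n (≤∧≢⇒< t≤ ne))

floor-mono : ∀ (P : ℕ → Bool) (y y' : ℕ) → y ≤ y' → floor P y ≤ floor P y'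
floor-mono P y zero z≤n = z≤n
floor-mono P y (suc y') le with P (suc y') in eq
... | true = ≤-trans (floor-≤ P y) le
... | false with y ≟ suc y'
... | yes refl rewrite eq = ≤-refl
... | no ne = floor-mono P y y' (m<1+n⇒m≤n (≤∧≢⇒< le ne))

floor-floor : ∀ (P Q : ℕ → Bool) → (∀ j → Q j ≡ true → P j ≡ true) → ∀ y → floor Q (floor P y) ≡ floor Q y
floor-floor P Q sub zero = refl
floor-floor P Q sub (suc y) with Q (suc y) in eq
... | true rewrite sub (suc y) eq = floor-fixed Q (suc y) eq
... | false with P (suc y)
... | true rewrite eq = refl
... | false = floor-floor P Q sub y

floor-skip : ∀ (Q : ℕ → Bool) (M y : ℕ) → (∀ j → M < j → j ≤ y → Q j ≡ false) → M ≤ y → floor Q y ≡ floor Q M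
floor-skip Q M zero h z≤n = refl
floor-skip Q M (suc y) h le with M ≟ suc y
... | yes refl = refl
... | no ne rewrite h (suc y) (≤∧≢⇒< le ne) ≤-refl =
  floor-skip Q M y (λ j a b → h j a (m≤n⇒m≤1+n b)) (m<1+n⇒m≤n (≤∧≢⇒< le ne))

floor-agree : ∀ (P P' : ℕ → Bool) i → (∀ j → i < j → P j ≡ P' j) → ∀ y → i < floor P' y → floor P y ≡ floor P' y
floor-agree P P' i h zero ()
floor-agree P P' i h (suc y) lt with P' (suc y) in eq
... | true rewrite h (suc y) lt | eq = refl
... | false rewrite h (suc y) (≤-<-trans (<⇒≤ lt) (s≤s (floor-≤ P' y))) | eq = floor-agree P P' i h y lt

map-floor-fixed : ∀ P l → All (λ y → P y ≡ true) l → map (floor P) l ≡ l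
map-floor-fixed P [] [] = refl
map-floor-fixed P (x ∷ l) (p ∷ ps) = cong₂ _∷_ (floor-fixed P x p) (map-floor-fixed P l ps)

map-floor-replicate : ∀ P c x y → floor P x ≡ y → map (floor P) (replicate c x) ≡ replicate c y
map-floor-replicate P c x y e rewrite map-replicate (floor P) c x | e = refl

lower : (ℕ → Bool) → Word → Word
lower P π = map (floor P) π

lettersExcept : Word → ℕ → ℕ → Bool
lettersExcept word w j = mem j word ∧ not (j ≡ᵇ w)

checkPark-∷⁻ : ∀ i x xs → T (checkPark i (x ∷ xs)) → 1 ≤ x × x ≤ i × T (checkPark (suc i) xs)
checkPark-∷⁻ i x xs t with Equivalence.to (BP.T-∧ {1 ≤ᵇ x}) t
... | t₁ , t₂ with Equivalence.to (BP.T-∧ {x ≤ᵇ i}) t₂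
... | t₃ , t₄ = ≤ᵇ⇒≤ 1 x t₁ , ≤ᵇ⇒≤ x i t₃ , t₄

checkPark-∷⁺ : ∀ i x xs → 1 ≤ x → x ≤ i → T (checkPark (suc i) xs) → T (checkPark i (x ∷ xs))
checkPark-∷⁺ i x xs p q t = Equivalence.from BP.T-∧ (≤⇒≤ᵇ p , Equivalence.from BP.T-∧ (≤⇒≤ᵇ q , t))

checkPark-bounds : ∀ i xs → T (checkPark i xs) → All (λ x → 1 ≤ x × x < i + length xs) xs
checkPark-bounds i [] t = []
checkPark-bounds i (x ∷ xs) t with checkPark-∷⁻ i x xs t
... | 1≤x , x≤i , t' =
  (1≤x , ≤-<-trans x≤i (m<m+n i z<s)) ∷
  All.map (λ {y} (a , b) → a , subst (y <_) (sym (+-suc i (length xs))) b) (checkPark-bounds (suc i) xs t')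

checkPark-map : ∀ (f : ℕ → ℕ) i xs → (∀ x → 1 ≤ x → 1 ≤ f x × f x ≤ x) → T (checkPark i xs) → T (checkPark i (map f xs))
checkPark-map f i [] h t = tt
checkPark-map f i (x ∷ xs) h t with checkPark-∷⁻ i x xs t
... | 1≤x , x≤i , t' = checkPark-∷⁺ i (f x) (map f xs) (proj₁ (h x 1≤x)) (≤-trans (proj₂ (h x 1≤x)) x≤i) (checkPark-map f (suc i) xs h t')

checkPark-shift : ∀ k i ys → T (checkPark i ys) → T (checkPark (k + i) (shift k ys))
checkPark-shift k i [] t = tt
checkPark-shift k i (y ∷ ys) t with checkPark-∷⁻ i y ys t
... | 1≤y , y≤i , t' =
  checkPark-∷⁺ (k + i) (k + y) (shift k ys) (≤-trans 1≤y (m≤n+m y k)) (+-monoʳ-≤ k y≤i)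
    (subst (λ q → T (checkPark q (shift k ys))) (+-suc k i) (checkPark-shift k (suc i) ys t'))

checkPark-++ : ∀ i xs ys → checkPark i (xs ++ ys) ≡ (checkPark i xs ∧ checkPark (i + length xs) ys)
checkPark-++ i [] ys rewrite +-identityʳ i = refl
checkPark-++ i (x ∷ xs) ys rewrite checkPark-++ (suc i) xs ys | +-suc i (length xs) =
  sym (trans (BP.∧-assoc (1 ≤ᵇ x) _ _) (cong ((1 ≤ᵇ x) ∧_) (BP.∧-assoc (x ≤ᵇ i) _ _)))

NDPF-checkPark : ∀ π → NDPF π → T (checkPark 1 π)
NDPF-checkPark π (s , p) = subst (λ w → T (checkPark 1 w)) (sort-sorted π s) p

NDPF-intro : ∀ π → Linked _≤_ π → T (checkPark 1 π) → NDPF π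
NDPF-intro π s p = s , subst (λ w → T (checkPark 1 w)) (sym (sort-sorted π s)) p

NDPF-bounds : ∀ π → NDPF π → All (λ x → 1 ≤ x × x ≤ length π) π
NDPF-bounds π n = All.map (λ (a , b) → a , ≤-pred b) (checkPark-bounds 1 π (NDPF-checkPark π n))

NDPF-≥1 : ∀ π → NDPF π → ∀ {y} → y ∈ π → 1 ≤ y
NDPF-≥1 π n p = proj₁ (All.lookup (NDPF-bounds π n) p)

NDPF-head : ∀ x xs → NDPF (x ∷ xs) → x ≡ 1
NDPF-head x xs n with checkPark-∷⁻ 1 x xs (NDPF-checkPark (x ∷ xs) n)
... | 1≤x , x≤1 , _ = ≤-antisym x≤1 1≤x

NDPF-lower : ∀ P π → P 1 ≡ true → NDPF π → NDPF (lower P π)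
NDPF-lower P π P1 n@(s , _) = NDPF-intro (lower P π) (linked-map (floor P) π (floor-mono P) s)
  (checkPark-map (floor P) 1 π (λ x 1≤x → floor-≥ P 1 x P1 1≤x , floor-≤ P x) (NDPF-checkPark π n))

shift-ge : ∀ k l → All (1 ≤_) l → All (suc k ≤_) (shift k l)
shift-ge k [] [] = []
shift-ge k (x ∷ l) (p ∷ ps) = subst (_≤ k + x) (+-comm k 1) (+-monoʳ-≤ k p) ∷ shift-ge k l ps

NDPF-• : ∀ π' π'' → NDPF π' → NDPF π'' → NDPF (π' • π'')
NDPF-• π' π'' n' n'' = NDPF-intro (π' • π'') sorted parking
  where
  k = length π'
  sorted : Linked _≤_ (π' • π'')
  sorted = linked-++ π' (shift k π'') (proj₁ n') (linked-map (k +_) π'' (λ x y → +-monoʳ-≤ k) (proj₁ n''))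
    (λ p q → ≤-trans (proj₂ (All.lookup (NDPF-bounds π' n') p))
              (≤-trans (n≤1+n k) (All.lookup (shift-ge k π'' (All.map proj₁ (NDPF-bounds π'' n''))) q)))
  parking : T (checkPark 1 (π' • π''))
  parking rewrite checkPark-++ 1 π' (shift k π'') =
    Equivalence.from BP.T-∧ (NDPF-checkPark π' n' ,
      subst (λ q → T (checkPark q (shift k π''))) (+-comm k 1) (checkPark-shift k 1 π'' (NDPF-checkPark π'' n'')))

count-++ : ∀ j xs ys → count j (xs ++ ys) ≡ count j xs + count j ys
count-++ j [] ys = refl
count-++ j (x ∷ xs) ys rewrite count-++ j xs ys = sym (+-assoc (if x ≡ᵇ j then 1 else 0) _ _)

count-replicate-≢ : ∀ j c i → i ≢ j → count j (replicate c i) ≡ 0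
count-replicate-≢ j zero i ne = refl
count-replicate-≢ j (suc c) i ne rewrite ≢⇒≡ᵇ≡false i j ne = count-replicate-≢ j c i ne

count-All> : ∀ i z → All (i <_) z → count i z ≡ 0
count-All> i [] [] = refl
count-All> i (x ∷ z) (p ∷ ps) rewrite ≢⇒≡ᵇ≡false x i (λ e → <-irrefl (sym e) p) = count-All> i z ps

evFrom-skip : ∀ j k c i w → i < j → evFrom j k (replicate c i ++ w) ≡ evFrom j k w
evFrom-skip j zero c i w lt = refl
evFrom-skip j (suc k) c i w lt
  rewrite count-++ j (replicate c i) w | count-replicate-≢ j c i (λ e → <-irrefl e lt)
  = cong (count j w ∷_) (evFrom-skip (suc j) k c i w (m≤n⇒m≤1+n lt))

span-replicate : ∀ i z → Linked _≤_ z → All (i ≤_) z →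
  ∃ λ z' → (z ≡ replicate (count i z) i ++ z') × All (i <_) z' × Linked _≤_ z'
span-replicate i [] l a = [] , refl , [] , []
span-replicate i (x ∷ zs) l (p ∷ ps) with x ≟ i
... | yes refl with span-replicate i zs (Linked.tail l) (linked-all x zs l)
... | z' , e , a' , l' rewrite ≡ᵇ-refl i = z' , cong (i ∷_) e , a' , l'
span-replicate i (x ∷ zs) l (p ∷ ps) | no ne
  rewrite ≢⇒≡ᵇ≡false x i ne | count-All> i zs (All.map (<-≤-trans (≤∧≢⇒< p (ne ∘ sym))) (linked-all x zs l)) =
  x ∷ zs , refl , i<x ∷ above , l
  where
  i<x = ≤∧≢⇒< p (ne ∘ sym)
  above = All.map (<-≤-trans i<x) (linked-all x zs l)

fromEvFrom-evFrom : ∀ k i z → Linked _≤_ z → All (λ x → i ≤ x × x < i + k) z → fromEvFrom i (evFrom i k z) ≡ z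
fromEvFrom-evFrom zero i [] l a = refl
fromEvFrom-evFrom zero i (x ∷ z) l ((p , q) ∷ _) = ⊥-elim (<-irrefl refl (≤-<-trans p (subst (x <_) (+-identityʳ i) q)))
fromEvFrom-evFrom (suc k) i z l a with span-replicate i z l (All.map proj₁ a)
... | z' , e , a' , l' =
  begin
    block ++ fromEvFrom (suc i) (evFrom (suc i) k z)
  ≡⟨ cong (λ w → block ++ fromEvFrom (suc i) (evFrom (suc i) k w)) e ⟩
    block ++ fromEvFrom (suc i) (evFrom (suc i) k (block ++ z'))
  ≡⟨ cong (λ w → block ++ fromEvFrom (suc i) w) (evFrom-skip (suc i) k (count i z) i z' ≤-refl) ⟩
    block ++ fromEvFrom (suc i) (evFrom (suc i) k z')
  ≡⟨ cong (block ++_) (fromEvFrom-evFrom k (suc i) z' l' bounds) ⟩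
    block ++ z'
  ≡⟨ sym e ⟩
    z
  ∎
  where
  open ≡-Reasoning
  block = replicate (count i z) i
  bounds : All (λ x → suc i ≤ x × x < suc i + k) z'
  bounds = All.zipWith (λ {x} (p , (_ , q)) → p , subst (x <_) (+-suc i k) q)
             (a' , AllP.++⁻ʳ block (subst (All (λ x → i ≤ x × x < i + suc k)) e a))

fromEv-ev : ∀ z → NDPF z → fromEv (ev z) ≡ z
fromEv-ev z n = fromEvFrom-evFrom (length z) 1 z (proj₁ n) (All.map (λ (a , b) → a , s≤s b) (NDPF-bounds z n))

fromEvFrom-≥ : ∀ j m → All (j ≤_) (fromEvFrom j m)
fromEvFrom-≥ j [] = []
fromEvFrom-≥ j (c ∷ m) = AllP.++⁺ (AllP.replicate⁺ c ≤-refl) (All.map (≤-trans (n≤1+n j)) (fromEvFrom-≥ (suc j) m))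

fromEvFrom-zeros : ∀ j z r → fromEvFrom j (replicate z 0 ++ r) ≡ fromEvFrom (j + z) r
fromEvFrom-zeros j zero r rewrite +-identityʳ j = refl
fromEvFrom-zeros j (suc z) r rewrite +-suc j z = fromEvFrom-zeros (suc j) z r

lettersExcept-∈ : ∀ word w {y} → y ∈ word → y ≢ w → lettersExcept word w y ≡ true
lettersExcept-∈ word w {y} y∈ ne rewrite ∈→mem y word y∈ | ≢⇒≡ᵇ≡false y w ne = refl

lettersExcept-self : ∀ word w → lettersExcept word w w ≡ false
lettersExcept-self word w rewrite ≡ᵇ-refl w = BP.∧-zeroʳ (mem w word)

lettersExcept-∉ : ∀ word w {y} → ¬ y ∈ word → lettersExcept word w y ≡ false
lettersExcept-∉ word w {y} y∉ rewrite ∉→mem y word y∉ = refl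

-- x arises from z by deleting a letter w of z that is not its smallest letter: every
-- occurrence of w becomes the next smaller letter of z.
DropsLetter : Word → Word → Set
DropsLetter z x = Σ ℕ λ w → Σ ℕ λ w'' → (w ∈ z) × (w'' ∈ z) × (w'' < w) × (x ≡ lower (lettersExcept z w) z)

merge-as-lowering : ∀ i a z b l' →
  let w = suc i + z
      word = replicate (suc a) i ++ fromEvFrom (suc i) (replicate z 0 ++ suc b ∷ l')
  in fromEvFrom i ((suc a + suc b) ∷ replicate z 0 ++ 0 ∷ l') ≡ lower (lettersExcept word w) word
merge-as-lowering i a z b l' =
  begin
    replicate (suc a + suc b) i ++ fromEvFrom (suc i) (replicate z 0 ++ 0 ∷ l')
  ≡⟨ cong₂ _++_ (replicate-+ (suc a) (suc b) i) (fromEvFrom-zeros (suc i) z (0 ∷ l')) ⟩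
    (replicate (suc a) i ++ replicate (suc b) i) ++ R
  ≡⟨ ++-assoc (replicate (suc a) i) (replicate (suc b) i) R ⟩
    replicate (suc a) i ++ replicate (suc b) i ++ R
  ≡⟨ sym (cong₂ _++_ (map-floor-replicate keep (suc a) i i fli)
          (cong₂ _++_ (map-floor-replicate keep (suc b) w i flw) (map-floor-fixed keep R allR))) ⟩
    lower keep (replicate (suc a) i) ++ lower keep (replicate (suc b) w) ++ lower keep R
  ≡⟨ sym (trans (map-++ (floor keep) (replicate (suc a) i) _)
                (cong (lower keep (replicate (suc a) i) ++_) (map-++ (floor keep) (replicate (suc b) w) R))) ⟩
    lower keep (replicate (suc a) i ++ replicate (suc b) w ++ R)
  ≡⟨ cong (lower keep) (sym word≡) ⟩
    lower keep word
  ∎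
  where
  open ≡-Reasoning
  w = suc i + z
  R = fromEvFrom (suc w) l'
  word = replicate (suc a) i ++ fromEvFrom (suc i) (replicate z 0 ++ suc b ∷ l')
  keep = lettersExcept word w
  word≡ : word ≡ replicate (suc a) i ++ replicate (suc b) w ++ R
  word≡ = cong (replicate (suc a) i ++_) (fromEvFrom-zeros (suc i) z (suc b ∷ l'))
  i<w : i < w
  i<w = s≤s (m≤m+n i z)
  allR : All (λ y → keep y ≡ true) R
  allR = All.tabulate λ {y} p →
    lettersExcept-∈ word w (subst (y ∈_) (sym word≡) (∈-++⁺ʳ (replicate (suc a) i) (∈-++⁺ʳ (replicate (suc b) w) p)))
      (λ e → <-irrefl (sym e) (All.lookup (fromEvFrom-≥ (suc w) l') p))
  fli : floor keep i ≡ i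
  fli = floor-fixed keep i (lettersExcept-∈ word w (here refl) (<⇒≢ i<w))
  gap : ∀ j → i < j → j ≤ w → keep j ≡ false
  gap j lt le with j ≟ w
  ... | yes refl = lettersExcept-self word w
  ... | no ne = lettersExcept-∉ word w j∉
    where
    j∉ : ¬ j ∈ word
    j∉ p with ∈-++⁻ (replicate (suc a) i) (subst (j ∈_) word≡ p)
    ... | inj₁ q = <⇒≢ lt (sym (∈-replicate⇒≡ (suc a) i j q))
    ... | inj₂ q with ∈-++⁻ (replicate (suc b) w) q
    ... | inj₁ q' = ne (∈-replicate⇒≡ (suc b) w j q')
    ... | inj₂ q' = <⇒≱ (s≤s le) (All.lookup (fromEvFrom-≥ (suc w) l') q')
  flw : floor keep w ≡ i
  flw = trans (floor-skip keep i w gap (<⇒≤ i<w)) fli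

prepend-lowering : ∀ i a m' v' w w'' →
  let W' = fromEvFrom (suc i) m'
      word = replicate (suc a) i ++ W'
  in w ∈ W' → w'' ∈ W' → w'' < w → fromEvFrom (suc i) v' ≡ lower (lettersExcept W' w) W' →
     fromEvFrom i (suc a ∷ v') ≡ lower (lettersExcept word w) word
prepend-lowering i a m' v' w w'' w∈ w''∈ lt e =
  begin
    replicate (suc a) i ++ fromEvFrom (suc i) v'
  ≡⟨ cong₂ _++_ (sym (map-floor-replicate keep (suc a) i i fli)) e ⟩
    lower keep (replicate (suc a) i) ++ lower keep' W'
  ≡⟨ cong (lower keep (replicate (suc a) i) ++_) (sym (map-cong-local (All.tabulate agree))) ⟩
    lower keep (replicate (suc a) i) ++ lower keep W'
  ≡⟨ sym (map-++ (floor keep) (replicate (suc a) i) W') ⟩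
    lower keep word
  ∎
  where
  open ≡-Reasoning
  W' = fromEvFrom (suc i) m'
  word = replicate (suc a) i ++ W'
  keep = lettersExcept word w
  keep' = lettersExcept W' w
  above-i : ∀ {y} → y ∈ W' → i < y
  above-i = All.lookup (fromEvFrom-≥ (suc i) m')
  fli : floor keep i ≡ i
  fli = floor-fixed keep i (lettersExcept-∈ word w (here refl) (<⇒≢ (above-i w∈)))
  same-above-i : ∀ j → i < j → keep j ≡ keep' j
  same-above-i j lt rewrite mem-++ j (replicate (suc a) i) W' | mem-replicate-≢ j (suc a) i (<⇒≢ lt) = refl
  agree : ∀ {y} → y ∈ W' → floor keep y ≡ floor keep' y
  agree {y} y∈ with y ≟ w
  ... | yes refl = floor-agree keep keep' i same-above-i y
        (<-≤-trans (above-i w''∈) (floor-≥ keep' w'' y (lettersExcept-∈ W' y w''∈ (<⇒≢ lt)) (<⇒≤ lt)))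
  ... | no ne = floor-agree keep keep' i same-above-i y
        (<-≤-trans (above-i y∈) (floor-≥ keep' y y (lettersExcept-∈ W' w y∈ ne) ≤-refl))

mergeNext-∈⁻ : ∀ a z l v → v ∈ mergeNext a z l →
  Σ ℕ λ z' → Σ ℕ λ b → Σ Word λ l' → (l ≡ replicate z' 0 ++ suc b ∷ l') × (v ≡ (a + suc b) ∷ replicate (z + z') 0 ++ 0 ∷ l')
mergeNext-∈⁻ a z (zero ∷ l) v p with mergeNext-∈⁻ a (suc z) l v p
... | z' , b , l' , refl , refl = suc z' , b , l' , refl , cong (λ q → (a + suc b) ∷ replicate q 0 ++ 0 ∷ l') (sym (+-suc z z'))
mergeNext-∈⁻ a z (suc b ∷ l) v (here refl) = 0 , b , l , refl , cong (λ q → (a + suc b) ∷ replicate q 0 ++ 0 ∷ l) (sym (+-identityʳ z))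

mergeNext-∈⁺ : ∀ a z z' b l' → ((a + suc b) ∷ replicate (z + z') 0 ++ 0 ∷ l') ∈ mergeNext a z (replicate z' 0 ++ suc b ∷ l')
mergeNext-∈⁺ a z zero b l' rewrite +-identityʳ z = here refl
mergeNext-∈⁺ a z (suc z') b l' rewrite +-suc z z' = mergeNext-∈⁺ a (suc z) z' b l'

succEv⇒DropsLetter : ∀ i m v → v ∈ succEv m → DropsLetter (fromEvFrom i m) (fromEvFrom i v)
succEv⇒DropsLetter i (zero ∷ m) v p with ∈-map⁻ (zero ∷_) p
... | v' , p' , refl = succEv⇒DropsLetter (suc i) m v' p'
succEv⇒DropsLetter i (suc a ∷ m) v p with ∈-++⁻ (mergeNext (suc a) 0 m) p
... | inj₁ q with mergeNext-∈⁻ (suc a) 0 m v q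
... | z' , b , l' , refl , refl =
  suc i + z' , i , w∈ , here refl , s≤s (m≤m+n i z') , merge-as-lowering i a z' b l'
  where
  w∈ : (suc i + z') ∈ fromEvFrom i (suc a ∷ replicate z' 0 ++ suc b ∷ l')
  w∈ = ∈-++⁺ʳ (replicate (suc a) i) (subst ((suc i + z') ∈_) (sym (fromEvFrom-zeros (suc i) z' (suc b ∷ l'))) (here refl))
succEv⇒DropsLetter i (suc a ∷ m) v p | inj₂ q with ∈-map⁻ (suc a ∷_) q
... | v' , p' , refl with succEv⇒DropsLetter (suc i) m v' p'
... | w , w'' , w∈ , w''∈ , lt , e =
  w , w'' , ∈-++⁺ʳ (replicate (suc a) i) w∈ , ∈-++⁺ʳ (replicate (suc a) i) w''∈ , lt , prepend-lowering i a m v' w w'' w∈ w''∈ lt e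

nonzero-entry : ∀ j m y → y ∈ fromEvFrom j m → Σ ℕ λ z → Σ ℕ λ b → Σ Word λ l' → m ≡ replicate z 0 ++ suc b ∷ l'
nonzero-entry j (zero ∷ m) y p with nonzero-entry (suc j) m y p
... | z , b , l' , refl = suc z , b , l' , refl
nonzero-entry j (suc b ∷ m) y p = 0 , b , m , refl

merge-succEv : ∀ i a m z b l' → m ≡ replicate z 0 ++ suc b ∷ l' →
  Σ Word λ v → (v ∈ succEv (suc a ∷ m)) × (fromEvFrom i v ≡ lower (lettersExcept (fromEvFrom i (suc a ∷ m)) (suc i + z)) (fromEvFrom i (suc a ∷ m)))
merge-succEv i a _ z b l' refl = (suc a + suc b) ∷ replicate z 0 ++ 0 ∷ l' , ∈-++⁺ˡ (mergeNext-∈⁺ (suc a) 0 z b l') , merge-as-lowering i a z b l'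

DropsLetter⇒succEv : ∀ i m w w'' → w ∈ fromEvFrom i m → w'' ∈ fromEvFrom i m → w'' < w →
  Σ Word λ v → (v ∈ succEv m) × (fromEvFrom i v ≡ lower (lettersExcept (fromEvFrom i m) w) (fromEvFrom i m))
DropsLetter⇒succEv i (zero ∷ m) w w'' a b lt with DropsLetter⇒succEv (suc i) m w w'' a b lt
... | v' , p , e = zero ∷ v' , ∈-map⁺ (zero ∷_) p , e
DropsLetter⇒succEv i (suc a ∷ m) w w'' w∈ w''∈ lt with ∈-++⁻ (replicate (suc a) i) w∈
... | inj₁ q = ⊥-elim (<⇒≱ lt (subst (_≤ w'') (sym (∈-replicate⇒≡ (suc a) i w q)) (All.lookup (fromEvFrom-≥ i (suc a ∷ m)) w''∈)))
... | inj₂ q with nonzero-entry (suc i) m w q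
... | z , b , l' , eqm with w ≟ suc i + z
... | yes refl = merge-succEv i a m z b l' eqm
... | no ne = suc a ∷ proj₁ rec , ∈-++⁺ʳ (mergeNext (suc a) 0 m) (∈-map⁺ (suc a ∷_) (proj₁ (proj₂ rec))) ,
                prepend-lowering i a m (proj₁ rec) w (suc i + z) q f∈ f<w (proj₂ (proj₂ rec))
  where
  f∈ : (suc i + z) ∈ fromEvFrom (suc i) m
  f∈ = subst (λ r → (suc i + z) ∈ fromEvFrom (suc i) r) (sym eqm)
         (subst ((suc i + z) ∈_) (sym (fromEvFrom-zeros (suc i) z (suc b ∷ l'))) (here refl))
  f<w : suc i + z < w
  f<w = ≤∧≢⇒< (All.lookup (fromEvFrom-≥ (suc i + z) (suc b ∷ l'))
                 (subst (w ∈_) (fromEvFrom-zeros (suc i) z (suc b ∷ l')) (subst (λ r → w ∈ fromEvFrom (suc i) r) eqm q)))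
              (ne ∘ sym)
  rec = DropsLetter⇒succEv (suc i) m w (suc i + z) q f∈ f<w

successor⇒DropsLetter : ∀ z x → NDPF z → x ∈ successors z → DropsLetter z x
successor⇒DropsLetter z x n p with ∈-map⁻ fromEv p
... | v , v∈ , refl = subst (λ q → DropsLetter q (fromEv v)) (fromEv-ev z n) (succEv⇒DropsLetter 1 (ev z) v v∈)

DropsLetter⇒successor : ∀ z w w'' → NDPF z → w ∈ z → w'' ∈ z → w'' < w → lower (lettersExcept z w) z ∈ successors z
DropsLetter⇒successor z w w'' n w∈ w''∈ lt
  with DropsLetter⇒succEv 1 (ev z) w w'' (subst (w ∈_) (sym (fromEv-ev z n)) w∈) (subst (w'' ∈_) (sym (fromEv-ev z n)) w''∈) lt
... | v , v∈ , e = subst (_∈ successors z) (trans e (cong (λ q → lower (lettersExcept q w) q) (fromEv-ev z n))) (∈-map⁺ fromEv v∈)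

sumℤ-++ : ∀ {A : Set} (f : A → ℤ) xs ys → sumℤ (map f (xs ++ ys)) ≡ sumℤ (map f xs) +ℤ sumℤ (map f ys)
sumℤ-++ f [] ys = sym (ℤP.+-identityˡ _)
sumℤ-++ f (x ∷ xs) ys rewrite sumℤ-++ f xs ys = sym (ℤP.+-assoc (f x) _ _)

sumℤ-↭ : ∀ {A : Set} (f : A → ℤ) {xs ys} → xs ↭ ys → sumℤ (map f xs) ≡ sumℤ (map f ys)
sumℤ-↭ f p = PermS.foldr-commMonoid ℤP.+-0-isCommutativeMonoid (↭⇒↭ₛ (PP.map⁺ f p))

sumℤ-cong : ∀ {A : Set} (f g : A → ℤ) xs → (∀ {x} → x ∈ xs → f x ≡ g x) → sumℤ (map f xs) ≡ sumℤ (map g xs)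
sumℤ-cong f g [] h = refl
sumℤ-cong f g (x ∷ xs) h = cong₂ _+ℤ_ (h (here refl)) (sumℤ-cong f g xs (h ∘ there))

sumℤ-map : ∀ {A B : Set} (f : B → ℤ) (g : A → B) xs → sumℤ (map f (map g xs)) ≡ sumℤ (map (f ∘ g) xs)
sumℤ-map f g xs = cong sumℤ (sym (map-∘ xs))

sumℤ-zero : ∀ {A : Set} (f : A → ℤ) xs → (∀ {x} → x ∈ xs → f x ≡ 0ℤ) → sumℤ (map f xs) ≡ 0ℤ
sumℤ-zero f [] h = refl
sumℤ-zero f (x ∷ xs) h rewrite h (here refl) | sumℤ-zero f xs (h ∘ there) = refl

sumℤ-neg : ∀ {A : Set} (f : A → ℤ) xs → sumℤ (map (λ x → - f x) xs) ≡ - sumℤ (map f xs)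
sumℤ-neg f [] = refl
sumℤ-neg f (x ∷ xs) rewrite sumℤ-neg f xs = sym (ℤP.neg-distrib-+ (f x) _)

mem-filter : ∀ (p : ℕ → Bool) j l → mem j (filterᵇ p l) ≡ (p j ∧ mem j l)
mem-filter p j [] = sym (BP.∧-zeroʳ (p j))
mem-filter p j (x ∷ l) with p x in eq | x ≟ j
... | true | yes refl rewrite ≡ᵇ-refl x | eq = refl
... | true | no ne rewrite ≢⇒≡ᵇ≡false x j ne = mem-filter p j l
... | false | yes refl rewrite ≡ᵇ-refl x | mem-filter p x l | eq = refl
... | false | no ne rewrite ≢⇒≡ᵇ≡false x j ne = mem-filter p j l

sublists : List ℕ → List (List ℕ)
sublists [] = [] ∷ []
sublists (x ∷ l) = map (x ∷_) (sublists l) ++ sublists l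

sublists-⊆ : ∀ l {S} → S ∈ sublists l → ∀ j → mem j S ≡ true → mem j l ≡ true
sublists-⊆ [] (here refl) j ()
sublists-⊆ (x ∷ l) p j m with ∈-++⁻ (map (x ∷_) (sublists l)) p
... | inj₂ q rewrite sublists-⊆ l q j m = BP.∨-zeroʳ (x ≡ᵇ j)
... | inj₁ q with ∈-map⁻ (x ∷_) q
... | S , q' , refl with x ≡ᵇ j
... | true = refl
... | false = sublists-⊆ l q' j m

filter∈sublists : ∀ (p : ℕ → Bool) l → filterᵇ p l ∈ sublists l
filter∈sublists p [] = here refl
filter∈sublists p (x ∷ l) with p x
... | true = ∈-++⁺ˡ (∈-map⁺ (x ∷_) (filter∈sublists p l))
... | false = ∈-++⁺ʳ (map (x ∷_) (sublists l)) (filter∈sublists p l)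

Unique-head-mem : ∀ x l → Unique (x ∷ l) → mem x l ≡ false
Unique-head-mem x l (h ∷ _) = ∉→mem x l (λ p → All.lookup h p refl)

sublists-Unique : ∀ l {S} → Unique l → S ∈ sublists l → Unique S
sublists-Unique [] u (here refl) = []
sublists-Unique (x ∷ l) (h ∷ u) p with ∈-++⁻ (map (x ∷_) (sublists l)) p
... | inj₂ q = sublists-Unique l u q
... | inj₁ q with ∈-map⁻ (x ∷_) q
... | S , q' , refl =
  All.tabulate (λ {y} y∈S → All.lookup h (mem→∈ y l (sublists-⊆ l q' y (∈→mem y S y∈S)))) ∷ sublists-Unique l u q'

map-sublists-Unique : ∀ {B : Set} l (g : List ℕ → B) → Unique l →
  (∀ {S S'} → S ∈ sublists l → S' ∈ sublists l → g S ≡ g S' → ∀ j → mem j S ≡ mem j S') →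
  Unique (map g (sublists l))
map-sublists-Unique [] g u h = [] ∷ []
map-sublists-Unique (x ∷ l) g (hx ∷ u) h rewrite map-++ g (map (x ∷_) (sublists l)) (sublists l) =
  UP.++⁺ (subst Unique (map-∘ (sublists l)) (map-sublists-Unique l (g ∘ (x ∷_)) u with-x))
         (map-sublists-Unique l g u without-x) disjoint
  where
  in-with : ∀ {S} → S ∈ sublists l → (x ∷ S) ∈ sublists (x ∷ l)
  in-with p = ∈-++⁺ˡ (∈-map⁺ (x ∷_) p)
  in-without : ∀ {S} → S ∈ sublists l → S ∈ sublists (x ∷ l)
  in-without = ∈-++⁺ʳ (map (x ∷_) (sublists l))
  x∉ : ∀ {S} → S ∈ sublists l → mem x S ≡ false
  x∉ {S} q = ∉→mem x S (λ x∈S → All.lookup hx (mem→∈ x l (sublists-⊆ l q x (∈→mem x S x∈S))) refl)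
  with-x : ∀ {S S'} → S ∈ sublists l → S' ∈ sublists l → g (x ∷ S) ≡ g (x ∷ S') → ∀ j → mem j S ≡ mem j S'
  with-x {S} {S'} p p' e j with x ≟ j
  ... | yes refl rewrite x∉ p | x∉ p' = refl
  ... | no ne = subst (λ b → (b ∨ mem j S) ≡ (b ∨ mem j S') → mem j S ≡ mem j S') (sym (≢⇒≡ᵇ≡false x j ne)) id
                   (h (in-with p) (in-with p') e j)
  without-x : ∀ {S S'} → S ∈ sublists l → S' ∈ sublists l → g S ≡ g S' → ∀ j → mem j S ≡ mem j S'
  without-x p p' = h (in-without p) (in-without p')
  disjoint : ∀ {v} → ¬ (v ∈ map g (map (x ∷_) (sublists l)) × v ∈ map g (sublists l))
  disjoint (a , b) with ∈-map⁻ g a | ∈-map⁻ g b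
  ... | _ , a' , refl | S' , b' , e with ∈-map⁻ (x ∷_) a'
  ... | S , a'' , refl with h (in-with a'') (in-without b') e x
  ... | r rewrite ≡ᵇ-refl x | x∉ b' = true≢false r

-- Lowerings and the up-set

Admissible : Word → (ℕ → Bool) → Set
Admissible π P = (P 1 ≡ true) × (∀ j → P j ≡ true → j ∈ π)

mem-lower : ∀ P π → NDPF π → Admissible π P → ∀ j → mem j (lower P π) ≡ P j
mem-lower P π n (P1 , sub) j with P j in e
... | true = ∈→mem j (lower P π) (subst (_∈ lower P π) (floor-fixed P j e) (∈-map⁺ (floor P) (sub j e)))
... | false with mem j (lower P π) in e'
... | false = refl
... | true with ∈-map⁻ (floor P) (mem→∈ j (lower P π) e')
... | y , y∈ , refl = ⊥-elim (true≢false (trans (sym (floor-satisfies P 1 y P1 (NDPF-≥1 π n y∈))) e))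

mem-lower⇒ : ∀ P π → NDPF π → Admissible π P → ∀ j → mem j (lower P π) ≡ true → P j ≡ true
mem-lower⇒ P π n g j e = trans (sym (mem-lower P π n g j)) e

map-floor-lower : ∀ P Q π → (∀ j → Q j ≡ true → P j ≡ true) → map (floor Q) (lower P π) ≡ lower Q π
map-floor-lower P Q π sub = trans (sym (map-∘ π)) (map-cong-local (All.tabulate (λ {y} _ → floor-floor P Q sub y)))

lower-cong : ∀ P Q π → (∀ j → P j ≡ Q j) → lower P π ≡ lower Q π
lower-cong P Q π e = map-cong-local (All.tabulate (λ {y} _ → floor-cong P Q e y))

lower-letters : ∀ π → lower (λ j → mem j π) π ≡ π
lower-letters π = map-floor-fixed (λ j → mem j π) π (All.tabulate (λ {y} p → ∈→mem y π p))

upIter-⁻ : ∀ k π x → x ∈ upIter (suc k) π → (x ∈ upIter k π) ⊎ (Σ Word λ z → (z ∈ upIter k π) × (x ∈ successors z))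
upIter-⁻ k π x p with ∈-++⁻ (upIter k π) (∈-deduplicate⁻ _≟w_ (upIter k π ++ concatMap successors (upIter k π)) p)
... | inj₁ q = inj₁ q
... | inj₂ q = inj₂ (find (∈-concatMap⁻ successors {xs = upIter k π} q))

upIter-⁺₁ : ∀ k π x → x ∈ upIter k π → x ∈ upIter (suc k) π
upIter-⁺₁ k π x p = ∈-deduplicate⁺ _≟w_ (∈-++⁺ˡ p)

upIter-⁺₂ : ∀ k π z x → z ∈ upIter k π → x ∈ successors z → x ∈ upIter (suc k) π
upIter-⁺₂ k π z x p q = ∈-deduplicate⁺ _≟w_ (∈-++⁺ʳ (upIter k π) (∈-concatMap⁺ successors (lose p q)))

upIter-mono : ∀ k e π x → x ∈ upIter k π → x ∈ upIter (e + k) π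
upIter-mono k zero π x p = p
upIter-mono k (suc e) π x p = upIter-⁺₁ (e + k) π x (upIter-mono k e π x p)

upIter⇒lowering : ∀ π → NDPF π → 1 ∈ π → ∀ k x → x ∈ upIter k π → Σ (ℕ → Bool) λ P → Admissible π P × (x ≡ lower P π)
upIter⇒lowering π n one zero x (here refl) = (λ j → mem j π) , (∈→mem 1 π one , λ j e → mem→∈ j π e) , sym (lower-letters π)
upIter⇒lowering π n one (suc k) x p with upIter-⁻ k π x p
... | inj₁ q = upIter⇒lowering π n one k x q
... | inj₂ (z , z∈ , x∈) with upIter⇒lowering π n one k z z∈
... | P , g@(P1 , sub) , refl with successor⇒DropsLetter (lower P π) x (NDPF-lower P π P1 n) x∈
... | w , w'' , w∈ , w''∈ , lt , refl = P' , (P'1 , λ j e → sub j (P'⊆P j e)) , map-floor-lower P P' π P'⊆P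
  where
  P' = lettersExcept (lower P π) w
  P'⊆P : ∀ j → P' j ≡ true → P j ≡ true
  P'⊆P j e = mem-lower⇒ P π n g j (∧≡true⇒ˡ e)
  1<w : 1 < w
  1<w = ≤-<-trans (NDPF-≥1 (lower P π) (NDPF-lower P π P1 n) w''∈) lt
  P'1 : P' 1 ≡ true
  P'1 rewrite mem-lower P π n g 1 | P1 | ≢⇒≡ᵇ≡false 1 w (<⇒≢ 1<w) = refl

lowering⇒upIter : ∀ π → NDPF π → 1 ∈ π → ∀ Rm → Unique Rm → All (λ w → (w ∈ π) × (w ≢ 1)) Rm →
  lower (λ j → mem j π ∧ not (mem j Rm)) π ∈ upIter (length Rm) π
lowering⇒upIter π n one [] u a = here (trans (lower-cong _ (λ j → mem j π) π (λ j → BP.∧-identityʳ (mem j π))) (lower-letters π))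
lowering⇒upIter π n one (w ∷ Rm) (hu ∷ u) ((w∈π , w≢1) ∷ a) =
  subst (_∈ upIter (suc (length Rm)) π) z-without-w (upIter-⁺₂ (length Rm) π z _ (lowering⇒upIter π n one Rm u a) successor)
  where
  keep : ℕ → Bool
  keep j = mem j π ∧ not (mem j Rm)
  keep-∈ : ∀ {j} → j ∈ π → ¬ j ∈ Rm → keep j ≡ true
  keep-∈ {j} j∈ j∉ rewrite ∈→mem j π j∈ | ∉→mem j Rm j∉ = refl
  g : Admissible π keep
  g = keep-∈ one (λ p → proj₂ (All.lookup a p) refl) , λ j e → mem→∈ j π (∧≡true⇒ˡ e)
  z = lower keep π
  w∈z : w ∈ z
  w∈z = mem→∈ w z (trans (mem-lower keep π n g w) (keep-∈ w∈π (λ p → All.lookup hu p refl)))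
  1∈z : 1 ∈ z
  1∈z = mem→∈ 1 z (trans (mem-lower keep π n g 1) (proj₁ g))
  successor : lower (lettersExcept z w) z ∈ successors z
  successor = DropsLetter⇒successor z w 1 (NDPF-lower keep π (proj₁ g) n) w∈z 1∈z (≤∧≢⇒< (NDPF-≥1 π n w∈π) (w≢1 ∘ sym))
  reassoc : ∀ a b c → ((a ∧ not b) ∧ not c) ≡ (a ∧ not (c ∨ b))
  reassoc false b c = refl
  reassoc true false false = refl
  reassoc true false true = refl
  reassoc true true false = refl
  reassoc true true true = refl
  z-without-w : lower (lettersExcept z w) z ≡ lower (λ j → mem j π ∧ not (mem j (w ∷ Rm))) π
  z-without-w = trans (map-floor-lower keep (lettersExcept z w) π (λ j e → mem-lower⇒ keep π n g j (∧≡true⇒ˡ e)))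
          (lower-cong _ _ π (λ j → trans (cong (λ q → q ∧ not (j ≡ᵇ w)) (mem-lower keep π n g j))
             (trans (reassoc (mem j π) (mem j Rm) (j ≡ᵇ w)) (cong (λ q → mem j π ∧ not (q ∨ mem j Rm)) (≡ᵇ-sym j w)))))

upperLetters : Word → Word
upperLetters π₀ = filter (¬? ∘ (_≟_ 1)) (deduplicate _≟_ π₀)

1∷upperLetters-Unique : ∀ π₀ → Unique (1 ∷ upperLetters π₀)
1∷upperLetters-Unique π₀ = deduplicate-! (1 ∷ π₀)

upperLetters-Unique : ∀ π₀ → Unique (upperLetters π₀)
upperLetters-Unique π₀ = AllPairs.tail (1∷upperLetters-Unique π₀)

1∉upperLetters : ∀ π₀ → mem 1 (upperLetters π₀) ≡ false
1∉upperLetters π₀ = Unique-head-mem 1 (upperLetters π₀) (1∷upperLetters-Unique π₀)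

mem-upperLetters : ∀ π₀ j → j ≢ 1 → mem j (upperLetters π₀) ≡ mem j (1 ∷ π₀)
mem-upperLetters π₀ j ne = bool-ext _ _ to from
  where
  to : mem j (upperLetters π₀) ≡ true → mem j (1 ∷ π₀) ≡ true
  to e = ∈→mem j (1 ∷ π₀) (∈-deduplicate⁻ _≟_ (1 ∷ π₀) (there (mem→∈ j (upperLetters π₀) e)))
  from : mem j (1 ∷ π₀) ≡ true → mem j (upperLetters π₀) ≡ true
  from e with ∈-deduplicate⁺ _≟_ {1 ∷ π₀} (mem→∈ j (1 ∷ π₀) e)
  ... | here refl = ⊥-elim (ne refl)
  ... | there p = ∈→mem j (upperLetters π₀) p

sublists-upperLetters-1∉ : ∀ π₀ {S} → S ∈ sublists (upperLetters π₀) → mem 1 S ≡ false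
sublists-upperLetters-1∉ π₀ q = bool-ext _ _ (λ e → trans (sym (1∉upperLetters π₀)) (sublists-⊆ (upperLetters π₀) q 1 e)) (λ ())

mem-1∷ : ∀ j S → j ≢ 1 → mem j (1 ∷ S) ≡ mem j S
mem-1∷ j S ne rewrite ≢⇒≡ᵇ≡false 1 j (ne ∘ sym) = refl

lowerTo : Word → List ℕ → Word
lowerTo π S = lower (λ j → mem j (1 ∷ S)) π

upEnum : Word → List Word
upEnum π₀ = map (lowerTo (1 ∷ π₀)) (sublists (upperLetters π₀))

lowerTo-Admissible : ∀ π₀ S → S ∈ sublists (upperLetters π₀) → Admissible (1 ∷ π₀) (λ j → mem j (1 ∷ S))
lowerTo-Admissible π₀ S p = refl , λ j e → mem→∈ j (1 ∷ π₀) (kept j e)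
  where
  kept : ∀ j → mem j (1 ∷ S) ≡ true → mem j (1 ∷ π₀) ≡ true
  kept j e with j ≟ 1
  ... | yes refl = refl
  ... | no ne = trans (sym (mem-upperLetters π₀ j ne)) (sublists-⊆ (upperLetters π₀) p j (trans (sym (mem-1∷ j S ne)) e))

upSet⊆upEnum : ∀ π₀ → NDPF (1 ∷ π₀) → ∀ x → x ∈ upSet (1 ∷ π₀) → x ∈ upEnum π₀
upSet⊆upEnum π₀ n x p with upIter⇒lowering (1 ∷ π₀) n (here refl) (length (1 ∷ π₀)) x p
... | P , (P1 , sub) , refl =
  subst (_∈ upEnum π₀) (sym (lower-cong P _ (1 ∷ π₀) same)) (∈-map⁺ (lowerTo (1 ∷ π₀)) (filter∈sublists P (upperLetters π₀)))
  where
  same : ∀ j → P j ≡ mem j (1 ∷ filterᵇ P (upperLetters π₀))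
  same j with j ≟ 1
  ... | yes refl = P1
  ... | no ne rewrite mem-1∷ j (filterᵇ P (upperLetters π₀)) ne | mem-filter P j (upperLetters π₀) | mem-upperLetters π₀ j ne =
    bool-ext _ _ (λ e → subst (λ q → (q ∧ mem j (1 ∷ π₀)) ≡ true) (sym e) (∈→mem j (1 ∷ π₀) (sub j e))) ∧≡true⇒ˡ

upEnum⊆upSet : ∀ π₀ → NDPF (1 ∷ π₀) → ∀ x → x ∈ upEnum π₀ → x ∈ upSet (1 ∷ π₀)
upEnum⊆upSet π₀ n x p with ∈-map⁻ (lowerTo (1 ∷ π₀)) p
... | S , S∈ , refl =
  subst (_∈ upSet π) (lower-cong keep (λ j → mem j (1 ∷ S)) π same)
    (subst (λ k → lower keep π ∈ upIter k π) (m∸n+n≡m removed≤)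
      (upIter-mono (length removed) (length π ∸ length removed) π (lower keep π)
        (lowering⇒upIter π n (here refl) removed removed-Unique removed-letters)))
  where
  π = 1 ∷ π₀
  d = upperLetters π₀
  absent : ℕ → Bool
  absent j = not (mem j S)
  removed = filterᵇ absent d
  keep : ℕ → Bool
  keep j = mem j π ∧ not (mem j removed)
  removed-Unique : Unique removed
  removed-Unique = UP.filter⁺ (T? ∘ absent) (upperLetters-Unique π₀)
  removed⊆d : ∀ {w} → w ∈ removed → mem w d ≡ true
  removed⊆d {w} q = ∈→mem w d (proj₁ (∈-filter⁻ (T? ∘ absent) {xs = d} q))
  removed-≢1 : ∀ {w} → w ∈ removed → w ≢ 1
  removed-≢1 q refl = true≢false (trans (sym (removed⊆d q)) (1∉upperLetters π₀))
  removed-letters : All (λ w → (w ∈ π) × (w ≢ 1)) removed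
  removed-letters = All.tabulate λ {w} q →
    mem→∈ w π (trans (sym (mem-upperLetters π₀ w (removed-≢1 q))) (removed⊆d q)) , removed-≢1 q
  removed≤ : length removed ≤ length π
  removed≤ = ≤-trans (length-filter (T? ∘ absent) d)
               (≤-trans (length-filter (¬? ∘ (_≟_ 1)) (deduplicate _≟_ π₀)) (≤-trans (length-deduplicate _≟_ π₀) (n≤1+n _)))
  truth-table : ∀ a s → (s ≡ true → a ≡ true) → (a ∧ not (not s ∧ a)) ≡ s
  truth-table false false h = refl
  truth-table false true h = h refl
  truth-table true false h = refl
  truth-table true true h = refl
  same : ∀ j → keep j ≡ mem j (1 ∷ S)
  same j with j ≟ 1
  ... | yes refl rewrite mem-filter absent 1 d | 1∉upperLetters π₀ | BP.∧-zeroʳ (not (mem 1 S)) = refl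
  ... | no ne rewrite mem-1∷ j S ne | mem-filter absent j d | mem-upperLetters π₀ j ne =
    truth-table (mem j π) (mem j S) (λ e → trans (sym (mem-upperLetters π₀ j ne)) (sublists-⊆ d S∈ j e))

upEnum-Unique : ∀ π₀ → NDPF (1 ∷ π₀) → Unique (upEnum π₀)
upEnum-Unique π₀ n = map-sublists-Unique (upperLetters π₀) (lowerTo (1 ∷ π₀)) (upperLetters-Unique π₀) same-letters
  where
  same-letters : ∀ {S S'} → S ∈ sublists (upperLetters π₀) → S' ∈ sublists (upperLetters π₀) →
                 lowerTo (1 ∷ π₀) S ≡ lowerTo (1 ∷ π₀) S' → ∀ j → mem j S ≡ mem j S'
  same-letters {S} {S'} p p' e j with j ≟ 1
  ... | yes refl = trans (sublists-upperLetters-1∉ π₀ p) (sym (sublists-upperLetters-1∉ π₀ p'))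
  ... | no ne =
    begin
      mem j S
    ≡⟨ sym (mem-1∷ j S ne) ⟩
      mem j (1 ∷ S)
    ≡⟨ sym (mem-lower _ (1 ∷ π₀) n (lowerTo-Admissible π₀ S p) j) ⟩
      mem j (lowerTo (1 ∷ π₀) S)
    ≡⟨ cong (mem j) e ⟩
      mem j (lowerTo (1 ∷ π₀) S')
    ≡⟨ mem-lower _ (1 ∷ π₀) n (lowerTo-Admissible π₀ S' p') j ⟩
      mem j (1 ∷ S')
    ≡⟨ mem-1∷ j S' ne ⟩
      mem j S'
    ∎
    where open ≡-Reasoning

-- Möbius inversion over the up-set

allB-cong : ∀ (p q : ℕ → Bool) σ → (∀ {j} → j ∈ σ → p j ≡ q j) → allB p σ ≡ allB q σ
allB-cong p q [] h = refl
allB-cong p q (x ∷ σ) h = cong₂ _∧_ (h (here refl)) (allB-cong p q σ (h ∘ there))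

allB-elim : ∀ (p : ℕ → Bool) σ → allB p σ ≡ true → ∀ {j} → j ∈ σ → p j ≡ true
allB-elim p (x ∷ σ) e (here refl) = ∧≡true⇒ˡ e
allB-elim p (x ∷ σ) e (there q) with p x
... | true = allB-elim p σ e q

allB-intro : ∀ (p : ℕ → Bool) σ → (∀ {j} → j ∈ σ → p j ≡ true) → allB p σ ≡ true
allB-intro p [] h = refl
allB-intro p (x ∷ σ) h rewrite h (here refl) = allB-intro p σ (h ∘ there)

allB-false : ∀ (p : ℕ → Bool) σ j → j ∈ σ → p j ≡ false → allB p σ ≡ false
allB-false p σ j j∈ pj with allB p σ in e
... | false = refl
... | true = trans (sym (allB-elim p σ e j∈)) pj

eqW-true : ∀ u v → eqW u v ≡ true → u ≡ v
eqW-true u v e with u ≟w v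
... | yes p = p

eqW-refl : ∀ u → eqW u u ≡ true
eqW-refl u with u ≟w u
... | yes _ = refl
... | no ne = ⊥-elim (ne refl)

Unique-set-↭ : ∀ {A : Set} (xs ys : List A) → Unique xs → Unique ys →
  (∀ j → j ∈ xs → j ∈ ys) → (∀ j → j ∈ ys → j ∈ xs) → xs ↭ ys
Unique-set-↭ xs ys u v f g = ∼bag⇒↭ (unique∧set⇒bag u v (λ {j} → mk⇔ (f j) (g j)))

altSign : List ℕ → ℤ
altSign [] = 1ℤ
altSign (_ ∷ l) = - altSign l

altSign-length : ∀ a b → length a ≡ length b → altSign a ≡ altSign b
altSign-length [] [] e = refl
altSign-length (x ∷ a) (y ∷ b) e = cong -_ (altSign-length a b (suc-injective e))

notIn : Word → ℕ → Bool
notIn σ j = not (mem j σ)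

altSign-filter-↭ : ∀ (xs ys : List ℕ) σ → xs ↭ ys → altSign (filterᵇ (notIn σ) xs) ≡ altSign (filterᵇ (notIn σ) ys)
altSign-filter-↭ xs ys σ p = altSign-length (filterᵇ (notIn σ) xs) (filterᵇ (notIn σ) ys) (↭-length (filter-↭ (T? ∘ notIn σ) p))

indicator : Bool → ℤ
indicator b = if b then 1ℤ else 0ℤ

if-neg : ∀ (b : Bool) (s : ℤ) → (if b then - s else 0ℤ) ≡ - (if b then s else 0ℤ)
if-neg true s = refl
if-neg false s = refl

altSum : (Q : ℕ → Bool) → Word → List ℕ → ℤ
altSum Q σ l = sumℤ (map (λ S → if allB (λ j → Q j ∨ mem j S) σ then altSign (filterᵇ (notIn σ) S) else 0ℤ) (sublists l))

-- A letter x ∉ σ pairs S with x ∷ S with opposite signs; a letter x ∈ σ moves into Q.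
altSum-sublists : ∀ Q σ l → Unique l → (∀ {x} → x ∈ l → Q x ≡ false) →
  altSum Q σ l ≡ indicator (allB (λ j → Q j ∨ mem j l) σ ∧ allB (λ j → mem j σ) l)
altSum-sublists Q σ [] u h rewrite allB-cong (λ j → Q j ∨ false) Q σ (λ {j} _ → BP.∨-identityʳ (Q j)) | BP.∧-identityʳ (allB Q σ) with allB Q σ
... | true = refl
... | false = refl
altSum-sublists Q σ (x ∷ l) (x∉l ∷ u) h =
  begin
    altSum Q σ (x ∷ l)
  ≡⟨ sumℤ-++ term (map (x ∷_) (sublists l)) (sublists l) ⟩
    sumℤ (map term (map (x ∷_) (sublists l))) +ℤ altSum Q σ l
  ≡⟨ cong (_+ℤ altSum Q σ l) (sumℤ-map term (x ∷_) (sublists l)) ⟩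
    sumℤ (map (term ∘ (x ∷_)) (sublists l)) +ℤ altSum Q σ l
  ≡⟨ by-x∈σ (mem x σ) refl ⟩
    indicator (allB (λ j → Q j ∨ mem j (x ∷ l)) σ ∧ allB (λ j → mem j σ) (x ∷ l))
  ∎
  where
  open ≡-Reasoning
  term : List ℕ → ℤ
  term S = if allB (λ j → Q j ∨ mem j S) σ then altSign (filterᵇ (notIn σ) S) else 0ℤ
  Q+x : ℕ → Bool
  Q+x j = Q j ∨ (x ≡ᵇ j)
  reassoc : ∀ S → allB (λ j → Q j ∨ mem j (x ∷ S)) σ ≡ allB (λ j → Q+x j ∨ mem j S) σ
  reassoc S = allB-cong _ _ σ (λ {j} _ → sym (BP.∨-assoc (Q j) (x ≡ᵇ j) (mem j S)))
  IH = altSum-sublists Q σ l u (h ∘ there)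
  IH+x = altSum-sublists Q+x σ l u (λ {y} p → trans (cong (_∨ (x ≡ᵇ y)) (h (there p))) (≢⇒≡ᵇ≡false x y (All.lookup x∉l p)))
  by-x∈σ : ∀ c → mem x σ ≡ c → sumℤ (map (term ∘ (x ∷_)) (sublists l)) +ℤ altSum Q σ l ≡
           indicator (allB (λ j → Q j ∨ mem j (x ∷ l)) σ ∧ (c ∧ allB (λ j → mem j σ) l))
  by-x∈σ true e =
    begin
      sumℤ (map (term ∘ (x ∷_)) (sublists l)) +ℤ altSum Q σ l
    ≡⟨ cong₂ _+ℤ_ with-x (trans IH (cong (λ c → indicator (c ∧ allB (λ j → mem j σ) l)) x-uncovered)) ⟩
      altSum Q+x σ l +ℤ 0ℤ
    ≡⟨ trans (ℤP.+-identityʳ _) IH+x ⟩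
      indicator (allB (λ j → Q+x j ∨ mem j l) σ ∧ allB (λ j → mem j σ) l)
    ≡⟨ cong (λ c → indicator (c ∧ allB (λ j → mem j σ) l)) (sym (reassoc l)) ⟩
      indicator (allB (λ j → Q j ∨ mem j (x ∷ l)) σ ∧ allB (λ j → mem j σ) l)
    ∎
    where
    x-kept : ∀ S → altSign (filterᵇ (notIn σ) (x ∷ S)) ≡ altSign (filterᵇ (notIn σ) S)
    x-kept S rewrite e = refl
    with-x : sumℤ (map (term ∘ (x ∷_)) (sublists l)) ≡ altSum Q+x σ l
    with-x = sumℤ-cong _ _ (sublists l) (λ {S} _ → cong₂ (λ c s → if c then s else 0ℤ) (reassoc S) (x-kept S))
    x-uncovered : allB (λ j → Q j ∨ mem j l) σ ≡ false
    x-uncovered = allB-false _ σ x (mem→∈ x σ e) (trans (cong (_∨ mem x l) (h (here refl))) (∉→mem x l (λ p → All.lookup x∉l p refl)))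
  by-x∈σ false e =
    begin
      sumℤ (map (term ∘ (x ∷_)) (sublists l)) +ℤ altSum Q σ l
    ≡⟨ cong (_+ℤ altSum Q σ l) with-x ⟩
      - altSum Q σ l +ℤ altSum Q σ l
    ≡⟨ ℤP.+-inverseˡ (altSum Q σ l) ⟩
      0ℤ
    ≡⟨ cong indicator (sym (BP.∧-zeroʳ _)) ⟩
      indicator (allB (λ j → Q j ∨ mem j (x ∷ l)) σ ∧ false)
    ∎
    where
    x-flips : ∀ S → altSign (filterᵇ (notIn σ) (x ∷ S)) ≡ - altSign (filterᵇ (notIn σ) S)
    x-flips S rewrite e = refl
    x-irrelevant : ∀ S → allB (λ j → Q j ∨ mem j (x ∷ S)) σ ≡ allB (λ j → Q j ∨ mem j S) σ
    x-irrelevant S = allB-cong _ _ σ (λ {j} j∈ → cong (λ c → Q j ∨ (c ∨ mem j S))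
                       (≢⇒≡ᵇ≡false x j (λ { refl → true≢false (trans (sym (∈→mem x σ j∈)) e) })))
    with-x : sumℤ (map (term ∘ (x ∷_)) (sublists l)) ≡ - altSum Q σ l
    with-x = trans (sumℤ-cong _ (λ S → - term S) (sublists l)
                      (λ {S} _ → trans (cong₂ (λ c s → if c then s else 0ℤ) (x-irrelevant S) (x-flips S)) (if-neg (allB (λ j → Q j ∨ mem j S) σ) (altSign (filterᵇ (notIn σ) S)))))
                   (sumℤ-neg term (sublists l))

-- rSupport x σ says σ ⪰ x: σ is the lowering of x to the letters of σ, and every letter of
-- σ occurs in x.
rSupport : Word → Word → Bool
rSupport x σ = eqW σ (lower (λ j → mem j σ) x) ∧ allB (λ j → mem j x) σ

rSign : Word → Word → ℤ
rSign x σ = altSign (filterᵇ (notIn σ) (deduplicate _≟_ x))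

rCoeff : Word → Word → ℤ
rCoeff x σ = if rSupport x σ then rSign x σ else 0ℤ

upSet↭upEnum : ∀ π₀ → NDPF (1 ∷ π₀) → upSet (1 ∷ π₀) ↭ upEnum π₀
upSet↭upEnum π₀ n = Unique-set-↭ _ _ (UDP.deduplicate-! _≟w_ _) (upEnum-Unique π₀ n) (upSet⊆upEnum π₀ n) (upEnum⊆upSet π₀ n)

rCoeff-lowerTo : ∀ π₀ → NDPF (1 ∷ π₀) → ∀ S → S ∈ sublists (upperLetters π₀) → ∀ σ →
  rCoeff (lowerTo (1 ∷ π₀) S) σ ≡
    (if eqW σ (lower (λ j → mem j σ) (1 ∷ π₀)) then (if allB (λ j → mem j (1 ∷ S)) σ then altSign (filterᵇ (notIn σ) (1 ∷ S)) else 0ℤ) else 0ℤ)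
rCoeff-lowerTo π₀ n S S∈ σ = by-cases (allB keep σ) refl
  where
  π = 1 ∷ π₀
  keep : ℕ → Bool
  keep j = mem j (1 ∷ S)
  g = lowerTo-Admissible π₀ S S∈
  x = lowerTo π S
  letters : allB (λ j → mem j x) σ ≡ allB keep σ
  letters = allB-cong _ _ σ (λ {j} _ → mem-lower keep π n g j)
  1∷S-Unique : Unique (1 ∷ S)
  1∷S-Unique = All.tabulate (λ {y} p e → true≢false (trans (sym (sublists-⊆ (upperLetters π₀) S∈ 1 (∈→mem 1 S (subst (_∈ S) (sym e) p)))) (1∉upperLetters π₀)))
               ∷ sublists-Unique (upperLetters π₀) (upperLetters-Unique π₀) S∈
  distinct : deduplicate _≟_ x ↭ (1 ∷ S)
  distinct = Unique-set-↭ _ _ (deduplicate-! x) 1∷S-Unique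
    (λ j p → mem→∈ j (1 ∷ S) (trans (sym (mem-lower keep π n g j)) (∈→mem j x (∈-deduplicate⁻ _≟_ x p))))
    (λ j p → ∈-deduplicate⁺ _≟_ (mem→∈ j x (trans (mem-lower keep π n g j) (∈→mem j (1 ∷ S) p))))
  by-cases : ∀ b → allB keep σ ≡ b →
    rCoeff x σ ≡ (if eqW σ (lower (λ j → mem j σ) π) then (if b then altSign (filterᵇ (notIn σ) (1 ∷ S)) else 0ℤ) else 0ℤ)
  by-cases true e rewrite letters | e | BP.∧-identityʳ (eqW σ (lower (λ j → mem j σ) x))
     | map-floor-lower keep (λ j → mem j σ) π (λ j h → allB-elim keep σ e (mem→∈ j σ h))
     | altSign-filter-↭ (deduplicate _≟_ x) (1 ∷ S) σ distinct = refl
  by-cases false e rewrite letters | e | BP.∧-zeroʳ (eqW σ (lower (λ j → mem j σ) x)) with eqW σ (lower (λ j → mem j σ) π)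
  ... | true = refl
  ... | false = refl

lower-0∈ : ∀ x σ → 1 ∈ x → σ ≡ lower (λ j → mem j σ) x → mem 1 σ ≡ false → 0 ∈ σ
lower-0∈ x σ 1∈x σ≡ m1 = subst (0 ∈_) (sym σ≡) (subst (_∈ lower (λ j → mem j σ) x) floor-1 (∈-map⁺ (floor (λ j → mem j σ)) 1∈x))
  where
  floor-1 : floor (λ j → mem j σ) 1 ≡ 0
  floor-1 rewrite m1 = refl

upperLetters-≢1 : ∀ π₀ {x} → x ∈ upperLetters π₀ → x ≢ 1
upperLetters-≢1 π₀ p refl = true≢false (trans (sym (∈→mem 1 (upperLetters π₀) p)) (1∉upperLetters π₀))

covers-upperLetters⇔≡ : ∀ π₀ σ → σ ≡ lower (λ j → mem j σ) (1 ∷ π₀) → mem 1 σ ≡ true →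
  (allB (λ j → (1 ≡ᵇ j) ∨ mem j (upperLetters π₀)) σ ∧ allB (λ j → mem j σ) (upperLetters π₀)) ≡ eqW σ (1 ∷ π₀)
covers-upperLetters⇔≡ π₀ σ σ-lowering m1 = bool-ext _ _ to from
  where
  π = 1 ∷ π₀
  d = upperLetters π₀
  π⊆σ : allB (λ j → mem j σ) d ≡ true → ∀ {y} → y ∈ π → mem y σ ≡ true
  π⊆σ d⊆σ {y} p with y ≟ 1
  ... | yes refl = m1
  ... | no ne = allB-elim _ d d⊆σ (mem→∈ y d (trans (mem-upperLetters π₀ y ne) (∈→mem y π p)))
  to : (allB (λ j → (1 ≡ᵇ j) ∨ mem j d) σ ∧ allB (λ j → mem j σ) d) ≡ true → eqW σ π ≡ true
  to h with allB (λ j → mem j σ) d in d⊆σ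
  ... | true = subst (λ s → eqW s π ≡ true) (sym (trans σ-lowering (map-floor-fixed _ π (All.tabulate (π⊆σ d⊆σ))))) (eqW-refl π)
  ... | false = ⊥-elim (true≢false (trans (sym h) (BP.∧-zeroʳ _)))
  covered : ∀ j → j ∈ π → ((1 ≡ᵇ j) ∨ mem j d) ≡ true
  covered j p with j ≟ 1
  ... | yes refl = refl
  ... | no ne rewrite ≢⇒≡ᵇ≡false 1 j (ne ∘ sym) = trans (mem-upperLetters π₀ j ne) (∈→mem j π p)
  from : eqW σ π ≡ true → (allB (λ j → (1 ≡ᵇ j) ∨ mem j d) σ ∧ allB (λ j → mem j σ) d) ≡ true
  from h with eqW-true σ π h
  ... | refl = cong₂ _∧_ (allB-intro _ π (λ {j} → covered j))
                 (allB-intro _ d (λ {j} p → trans (sym (mem-upperLetters π₀ j (upperLetters-≢1 π₀ p))) (∈→mem j d p)))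

-- The defining identity of the Möbius function of the Boolean lattice of letter sets.
sum-rCoeff-upEnum : ∀ π₀ → NDPF (1 ∷ π₀) → ∀ σ → sumℤ (map (λ x → rCoeff x σ) (upEnum π₀)) ≡ indicator (eqW σ (1 ∷ π₀))
sum-rCoeff-upEnum π₀ n σ =
  trans (sumℤ-map (λ x → rCoeff x σ) (lowerTo π) (sublists d))
  (trans (sumℤ-cong _ _ (sublists d) (λ {S} p → rCoeff-lowerTo π₀ n S p σ))
  (by-lowering (eqW σ (lower (λ j → mem j σ) π)) refl))
  where
  π = 1 ∷ π₀
  d = upperLetters π₀
  term : Bool → List ℕ → ℤ
  term c S = if c then (if allB (λ j → mem j (1 ∷ S)) σ then altSign (filterᵇ (notIn σ) (1 ∷ S)) else 0ℤ) else 0ℤ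
  0≡indicator : (eqW σ π ≡ true → ⊥) → 0ℤ ≡ indicator (eqW σ π)
  0≡indicator ne with eqW σ π
  ... | true = ⊥-elim (ne refl)
  ... | false = refl
  by-1∈σ : σ ≡ lower (λ j → mem j σ) π → ∀ b → mem 1 σ ≡ b → sumℤ (map (term true) (sublists d)) ≡ indicator (eqW σ π)
  by-1∈σ σ-lowering true m1 =
    trans (sumℤ-cong (term true) (λ S → if allB (λ j → (1 ≡ᵇ j) ∨ mem j S) σ then altSign (filterᵇ (notIn σ) S) else 0ℤ)
            (sublists d) (λ {S} _ → drop-1 S))
      (trans (altSum-sublists (1 ≡ᵇ_) σ d (upperLetters-Unique π₀) (λ {x} p → ≢⇒≡ᵇ≡false 1 x (upperLetters-≢1 π₀ p ∘ sym)))
             (cong indicator (covers-upperLetters⇔≡ π₀ σ σ-lowering m1)))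
    where
    drop-1 : ∀ S → term true S ≡ (if allB (λ j → (1 ≡ᵇ j) ∨ mem j S) σ then altSign (filterᵇ (notIn σ) S) else 0ℤ)
    drop-1 S rewrite m1 = refl
  by-1∈σ σ-lowering false m1 = trans (sumℤ-zero (term true) (sublists d) (λ {S} p → vanish S p))
                                 (0≡indicator (λ h → true≢false (trans (sym (cong (mem 1) (eqW-true σ π h))) m1)))
    where
    0∉π : mem 0 π ≡ false
    0∉π = ∉→mem 0 π (λ p → <-irrefl refl (NDPF-≥1 π n p))
    vanish : ∀ S → S ∈ sublists d → term true S ≡ 0ℤ
    vanish S p rewrite allB-false (λ j → mem j (1 ∷ S)) σ 0 (lower-0∈ π σ (here refl) σ-lowering m1)
        (bool-ext _ _ (λ h → trans (sym (trans (mem-upperLetters π₀ 0 (λ ())) 0∉π)) (sublists-⊆ d p 0 h)) (λ ())) = refl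
  by-lowering : ∀ c → eqW σ (lower (λ j → mem j σ) π) ≡ c → sumℤ (map (term c) (sublists d)) ≡ indicator (eqW σ π)
  by-lowering false e = trans (sumℤ-zero (term false) (sublists d) (λ _ → refl)) (0≡indicator π-not-lowering)
    where
    π-not-lowering : eqW σ π ≡ true → ⊥
    π-not-lowering h with eqW-true σ π h
    ... | refl = true≢false (trans (sym (trans (cong (eqW π) (lower-letters π)) (eqW-refl π))) e)
  by-lowering true e = by-1∈σ (eqW-true σ _ e) (mem 1 σ) refl

+ℤ-cancelʳ : ∀ a b x → a +ℤ x ≡ b +ℤ x → a ≡ b
+ℤ-cancelʳ a b x = ℤGroup.∙-cancelʳ x a b

sublists-head : ∀ l → Σ (List (List ℕ)) λ rest → sublists l ≡ l ∷ rest
sublists-head [] = [] , refl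
sublists-head (x ∷ l) with sublists-head l
... | rest , e rewrite e = map (x ∷_) rest ++ l ∷ rest , refl

sum-map-≤ : ∀ (f : ℕ → ℕ) l → (∀ y → f y ≤ y) → sum (map f l) ≤ sum l
sum-map-≤ f [] h = z≤n
sum-map-≤ f (y ∷ l) h = +-mono-≤ (h y) (sum-map-≤ f l h)

sum-map-< : ∀ (f : ℕ → ℕ) l → (∀ y → f y ≤ y) → map f l ≢ l → sum (map f l) < sum l
sum-map-< f [] h ne = ⊥-elim (ne refl)
sum-map-< f (y ∷ l) h ne with f y ≟ y
... | yes e = subst (λ q → q + sum (map f l) < y + sum l) (sym e) (+-monoʳ-< y (sum-map-< f l h (ne ∘ cong₂ _∷_ e)))
... | no ne' = +-mono-<-≤ (≤∧≢⇒< (h y) ne') (sum-map-≤ f l h)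

lowerTo-upperLetters : ∀ π₀ → lowerTo (1 ∷ π₀) (upperLetters π₀) ≡ 1 ∷ π₀
lowerTo-upperLetters π₀ = trans (lower-cong _ (λ j → mem j (1 ∷ π₀)) (1 ∷ π₀) same) (lower-letters (1 ∷ π₀))
  where
  same : ∀ j → mem j (1 ∷ upperLetters π₀) ≡ mem j (1 ∷ π₀)
  same j with j ≟ 1
  ... | yes refl = refl
  ... | no ne rewrite mem-1∷ j (upperLetters π₀) ne = mem-upperLetters π₀ j ne

RIsRCoeff : (R : Word → PQ) → ℕ → Set
RIsRCoeff R N = ∀ π₀ → sum (1 ∷ π₀) ≡ N → NDPF (1 ∷ π₀) → ∀ a → R (1 ∷ π₀) a ≡ rCoeff (1 ∷ π₀) (sort a)

-- π itself is the head of upEnum; every other element has a smaller letter sum.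
R≡rCoeff-step : (R : Word → PQ) → (∀ π → NDPF π → ∀ a → P π a ≡ sumUp R π a) →
  ∀ N → (∀ {M} → M < N → RIsRCoeff R M) → RIsRCoeff R N
R≡rCoeff-step R hyp N IH π₀ refl n a = +ℤ-cancelʳ _ _ others (trans (sym via-R) via-rCoeff)
  where
  π = 1 ∷ π₀
  σ = sort a
  rest = proj₁ (sublists-head (upperLetters π₀))
  upEnum≡ : upEnum π₀ ≡ π ∷ map (lowerTo π) rest
  upEnum≡ rewrite proj₂ (sublists-head (upperLetters π₀)) = cong (_∷ map (lowerTo π) rest) (lowerTo-upperLetters π₀)
  others = sumℤ (map (λ x → rCoeff x σ) (map (lowerTo π) rest))
  π∉rest : All (π ≢_) (map (lowerTo π) rest)
  π∉rest = AllPairs.head (subst Unique upEnum≡ (upEnum-Unique π₀ n))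
  smaller : ∀ {x} → x ∈ map (lowerTo π) rest → R x a ≡ rCoeff x σ
  smaller {x} p with upIter⇒lowering π n (here refl) (length π) x (upEnum⊆upSet π₀ n x (subst (x ∈_) (sym upEnum≡) (there p)))
  ... | Q , (Q1 , _) , refl = subst (λ y → R y a ≡ rCoeff y σ) (sym x≡) (IH lt (map (floor Q) π₀) (cong sum (sym x≡)) (subst NDPF x≡ (NDPF-lower Q π Q1 n)) a)
    where
    x≡ : lower Q π ≡ 1 ∷ map (floor Q) π₀
    x≡ rewrite Q1 = refl
    lt : sum (lower Q π) < sum π
    lt = sum-map-< (floor Q) π (floor-≤ Q) (λ e → All.lookup π∉rest p (sym e))
  via-R : P π a ≡ R π a +ℤ others
  via-R = trans (hyp π n a) (trans (sumℤ-↭ (λ x → R x a) (upSet↭upEnum π₀ n))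
            (trans (cong (λ l → sumℤ (map (λ x → R x a) l)) upEnum≡) (cong (R π a +ℤ_) (sumℤ-cong _ _ (map (lowerTo π) rest) smaller))))
  via-rCoeff : P π a ≡ rCoeff π σ +ℤ others
  via-rCoeff = sym (trans (cong (λ l → sumℤ (map (λ x → rCoeff x σ) l)) (sym upEnum≡)) (sum-rCoeff-upEnum π₀ n σ))

R≡rCoeff : (R : Word → PQ) → (∀ π → NDPF π → ∀ a → P π a ≡ sumUp R π a) →
  ∀ π₀ → NDPF (1 ∷ π₀) → ∀ a → R (1 ∷ π₀) a ≡ rCoeff (1 ∷ π₀) (sort a)
R≡rCoeff R hyp π₀ n a = <-rec (RIsRCoeff R) (λ N IH → R≡rCoeff-step R hyp N IH) (sum (1 ∷ π₀)) π₀ refl n a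

sumℤ-concatMap : ∀ {A B : Set} (h : B → ℤ) (F : A → List B) l → sumℤ (map h (concatMap F l)) ≡ sumℤ (map (λ e → sumℤ (map h (F e))) l)
sumℤ-concatMap h F [] = refl
sumℤ-concatMap h F (e ∷ l) = trans (sumℤ-++ h (F e) (concatMap F l)) (cong (sumℤ (map h (F e)) +ℤ_) (sumℤ-concatMap h F l))

sum-splits-single : ∀ (p : ℕ → Bool) (a : Word) (h : Word × Word → ℤ) →
  (∀ u v → (allB p u ∧ allB (λ x → not (p x)) v) ≡ false → h (u , v) ≡ 0ℤ) →
  sumℤ (map h (splits a)) ≡ h (filterᵇ p a , filterᵇ (λ x → not (p x)) a)
sum-splits-single p [] h c = ℤP.+-identityʳ _
sum-splits-single p (x ∷ xs) h c = trans (sumℤ-concatMap h F (splits xs)) (by-p (p x) refl)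
  where
  F : Word × Word → List (Word × Word)
  F = λ { (u , v) → (x ∷ u , v) ∷ (u , x ∷ v) ∷ [] }
  by-p : ∀ b → p x ≡ b → sumℤ (map (λ e → sumℤ (map h (F e))) (splits xs)) ≡ h (filterᵇ p (x ∷ xs) , filterᵇ (λ x → not (p x)) (x ∷ xs))
  by-p true e = trans (sumℤ-cong _ (λ { (u , v) → h (x ∷ u , v) }) (splits xs) (λ { {u , v} _ → only-left u v }))
     (trans (sum-splits-single p xs (λ { (u , v) → h (x ∷ u , v) }) (λ u v z → c (x ∷ u) v (trans (cong (λ q → (q ∧ allB p u) ∧ allB (λ x → not (p x)) v) e) z)))
       (cong h (cong₂ _,_ (sym (filter-accept (T? ∘ p) (≡true⇒T e))) (sym (filter-reject (T? ∘ (λ y → not (p y))) (λ t → subst T (cong not e) t))))))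
    where
    only-left : ∀ u v → (h (x ∷ u , v) +ℤ (h (u , x ∷ v) +ℤ 0ℤ)) ≡ h (x ∷ u , v)
    only-left u v rewrite c u (x ∷ v) (trans (cong (λ q → allB p u ∧ (not q ∧ allB (λ x → not (p x)) v)) e) (BP.∧-zeroʳ _)) = ℤP.+-identityʳ _
  by-p false e = trans (sumℤ-cong _ (λ { (u , v) → h (u , x ∷ v) }) (splits xs) (λ { {u , v} _ → only-right u v }))
     (trans (sum-splits-single p xs (λ { (u , v) → h (u , x ∷ v) }) (λ u v z → c u (x ∷ v) (trans (cong (λ q → allB p u ∧ (not q ∧ allB (λ x → not (p x)) v)) e) z)))
       (cong h (cong₂ _,_ (sym (filter-reject (T? ∘ p) (λ t → subst T e t))) (sym (filter-accept (T? ∘ (λ y → not (p y))) (≡true⇒T (cong not e)))))))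
    where
    only-right : ∀ u v → (h (x ∷ u , v) +ℤ (h (u , x ∷ v) +ℤ 0ℤ)) ≡ h (u , x ∷ v)
    only-right u v rewrite c (x ∷ u) v (cong (λ q → (q ∧ allB p u) ∧ allB (λ x → not (p x)) v) e) = trans (ℤP.+-identityˡ _) (ℤP.+-identityʳ _)

partition-↭ : ∀ (p : ℕ → Bool) a → a ↭ filterᵇ p a ++ filterᵇ (λ x → not (p x)) a
partition-↭ p [] = ↭-refl
partition-↭ p (x ∷ a) with p x
... | true = prep x (partition-↭ p a)
... | false = ↭-trans (prep x (partition-↭ p a)) (↭-sym (PP.shift x (filterᵇ p a) (filterᵇ (λ x → not (p x)) a)))

filterᵇ-cong : ∀ (p q : ℕ → Bool) xs → (∀ {j} → j ∈ xs → p j ≡ q j) → filterᵇ p xs ≡ filterᵇ q xs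
filterᵇ-cong p q [] h = refl
filterᵇ-cong p q (x ∷ xs) h with p x in e1 | q x in e2
... | true | true = cong (x ∷_) (filterᵇ-cong p q xs (h ∘ there))
... | false | false = filterᵇ-cong p q xs (h ∘ there)
... | true | false = ⊥-elim (true≢false (trans (sym e1) (trans (h (here refl)) e2)))
... | false | true = ⊥-elim (true≢false (trans (sym e2) (trans (sym (h (here refl))) e1)))

filterᵇ-map : ∀ (p : ℕ → Bool) (f : ℕ → ℕ) xs → filterᵇ p (map f xs) ≡ map f (filterᵇ (p ∘ f) xs)
filterᵇ-map p f [] = refl
filterᵇ-map p f (x ∷ xs) with p (f x)
... | true = cong (f x ∷_) (filterᵇ-map p f xs)
... | false = filterᵇ-map p f xs

filterᵇ-all : ∀ (p : ℕ → Bool) xs → All (λ x → p x ≡ true) xs → filterᵇ p xs ≡ xs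
filterᵇ-all p xs h = filter-all (T? ∘ p) (All.map ≡true⇒T h)

filterᵇ-none : ∀ (p : ℕ → Bool) xs → All (λ x → p x ≡ false) xs → filterᵇ p xs ≡ []
filterᵇ-none p xs h = filter-none (T? ∘ p) (All.map (λ e t → subst T e t) h)

filterᵇ-mem : ∀ (p : ℕ → Bool) xs {x} → x ∈ filterᵇ p xs → p x ≡ true
filterᵇ-mem p xs q = T⇒≡true (proj₂ (∈-filter⁻ (T? ∘ p) {xs = xs} q))

not-≤ᵇ : ∀ x k → not (x ≤ᵇ k) ≡ (k <ᵇ x)
not-≤ᵇ x k with x ≤? k
... | yes le rewrite T⇒≡true (≤⇒≤ᵇ le) = sym (¬T⇒≡false (λ t → <⇒≱ (<ᵇ⇒< k x t) le))
... | no nle rewrite T⇒≡true (<⇒<ᵇ (≰⇒> nle)) = cong not (¬T⇒≡false (λ t → nle (≤ᵇ⇒≤ x k t)))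

allB-++ : ∀ (p : ℕ → Bool) xs ys → allB p (xs ++ ys) ≡ (allB p xs ∧ allB p ys)
allB-++ p [] ys = refl
allB-++ p (x ∷ xs) ys rewrite allB-++ p xs ys = sym (BP.∧-assoc (p x) _ _)

allB-map : ∀ (p : ℕ → Bool) (f : ℕ → ℕ) xs → allB p (map f xs) ≡ allB (p ∘ f) xs
allB-map p f [] = refl
allB-map p f (x ∷ xs) rewrite allB-map p f xs = refl

allB-∧ : ∀ (p q : ℕ → Bool) xs → allB (λ j → p j ∧ q j) xs ≡ (allB p xs ∧ allB q xs)
allB-∧ p q [] = refl
allB-∧ p q (x ∷ xs) rewrite allB-∧ p q xs with p x | q x
... | true | true = refl
... | true | false = sym (BP.∧-zeroʳ _)
... | false | _ = refl

allB-≢ : ∀ c xs → allB (λ j → not (j ≡ᵇ c)) xs ≡ not (mem c xs)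
allB-≢ c [] = refl
allB-≢ c (x ∷ xs) rewrite allB-≢ c xs | ≡ᵇ-sym x c with c ≡ᵇ x
... | true = refl
... | false = refl

++-split : ∀ (A B C D : Word) → length A ≡ length C → A ++ B ≡ C ++ D → (A ≡ C) × (B ≡ D)
++-split [] B [] D l e = refl , e
++-split (x ∷ A) B (y ∷ C) D l e with ∷-injective e
... | refl , e' with ++-split A B C D (suc-injective l) e'
... | refl , refl = refl , refl

eqW-++ : ∀ (A B C D : Word) → length A ≡ length C → eqW (A ++ B) (C ++ D) ≡ (eqW A C ∧ eqW B D)
eqW-++ A B C D l = bool-ext _ _ to from
  where
  to : eqW (A ++ B) (C ++ D) ≡ true → (eqW A C ∧ eqW B D) ≡ true
  to e with ++-split A B C D l (eqW-true _ _ e)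
  ... | refl , refl rewrite eqW-refl A | eqW-refl B = refl
  from : (eqW A C ∧ eqW B D) ≡ true → eqW (A ++ B) (C ++ D) ≡ true
  from e with eqW A C in e1
  ... | true rewrite eqW-true _ _ e1 | eqW-true _ _ e = eqW-refl _

≡ᵇ-cancelˡ-+ : ∀ k x z → ((k + x) ≡ᵇ (k + z)) ≡ (x ≡ᵇ z)
≡ᵇ-cancelˡ-+ zero x z = refl
≡ᵇ-cancelˡ-+ (suc k) x z = ≡ᵇ-cancelˡ-+ k x z

eqW-shift : ∀ k (B D : Word) → eqW (shift k B) (shift k D) ≡ eqW B D
eqW-shift k B D = bool-ext _ _
  (λ e → subst (λ q → eqW q D ≡ true) (sym (map-injective (+-cancelˡ-≡ k _ _) (eqW-true _ _ e))) (eqW-refl D))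
  (λ e → subst (λ q → eqW (shift k q) (shift k D) ≡ true) (sym (eqW-true _ _ e)) (eqW-refl _))

mem-shift : ∀ k z l → mem (k + z) (shift k l) ≡ mem z l
mem-shift k z [] = refl
mem-shift k z (x ∷ l) rewrite ≡ᵇ-cancelˡ-+ k x z | mem-shift k z l = refl

mem-shift-below : ∀ k j l → All (1 ≤_) l → j ≤ k → mem j (shift k l) ≡ false
mem-shift-below k j l a le = mem-below (suc k) j (shift k l) (shift-ge k l a) (s≤s le)

altSign-++ : ∀ xs ys → altSign (xs ++ ys) ≡ altSign xs *ℤ altSign ys
altSign-++ [] ys = sym (ℤP.*-identityˡ _)
altSign-++ (x ∷ xs) ys rewrite altSign-++ xs ys = ℤP.neg-distribˡ-* (altSign xs) (altSign ys)

altSign-map : ∀ (f : ℕ → ℕ) xs → altSign (map f xs) ≡ altSign xs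
altSign-map f [] = refl
altSign-map f (x ∷ xs) = cong -_ (altSign-map f xs)

maxLetter-ub : ∀ xs {y} → y ∈ xs → y ≤ maxLetter xs
maxLetter-ub (x ∷ xs) (here refl) = m≤m⊔n x (maxLetter xs)
maxLetter-ub (x ∷ xs) (there p) = ≤-trans (maxLetter-ub xs p) (m≤n⊔m x (maxLetter xs))

maxLetter-∈ : ∀ x xs → maxLetter (x ∷ xs) ∈ (x ∷ xs)
maxLetter-∈ x [] = here (m≥n⇒m⊔n≡m z≤n)
maxLetter-∈ x (y ∷ xs) with x ≤? maxLetter (y ∷ xs)
... | yes le = subst (_∈ (x ∷ y ∷ xs)) (sym (m≤n⇒m⊔n≡n le)) (there (maxLetter-∈ y xs))
... | no nle = here (m≥n⇒m⊔n≡m (≰⇒≥ nle))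

maxLetter-lub : ∀ xs k → All (_≤ k) xs → maxLetter xs ≤ k
maxLetter-lub [] k [] = z≤n
maxLetter-lub (x ∷ xs) k (p ∷ ps) = ⊔-lub p (maxLetter-lub xs k ps)

▷-as-lowering : ∀ p₀ π'' → NDPF (1 ∷ p₀) → NDPF π'' →
  ((1 ∷ p₀) ▷ π'') ≡ lower (lettersExcept ((1 ∷ p₀) • π'') (suc (length (1 ∷ p₀)))) ((1 ∷ p₀) • π'')
▷-as-lowering p₀ π'' n' n'' =
  trans (cong₂ _++_ (sym (map-floor-fixed keep π' (All.tabulate keep-π'))) (map-cong-local (All.tabulate relabel)))
        (sym (map-++ (floor keep) π' (shift k π'')))
  where
  π' = 1 ∷ p₀
  k = length π'
  b = π' • π''
  keep = lettersExcept b (suc k)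
  M = maxLetter π'
  π'≤k = All.map proj₂ (NDPF-bounds π' n')
  π''≥1 = All.map proj₁ (NDPF-bounds π'' n'')
  keep-π' : ∀ {y} → y ∈ π' → keep y ≡ true
  keep-π' p = lettersExcept-∈ b (suc k) (∈-++⁺ˡ p) (λ e → <-irrefl e (s≤s (All.lookup π'≤k p)))
  gap : ∀ j → M < j → j ≤ suc k → keep j ≡ false
  gap j lt le with j ≟ suc k
  ... | yes refl = lettersExcept-self b (suc k)
  ... | no ne = cong (_∧ not (j ≡ᵇ suc k)) (trans (mem-++ j π' (shift k π''))
          (cong₂ _∨_ (mem-above M j π' (All.tabulate (maxLetter-ub π')) lt) (mem-shift-below k j π'' π''≥1 (m<1+n⇒m≤n (≤∧≢⇒< le ne)))))
  relabel : ∀ {y} → y ∈ shift k π'' → (if y ≡ᵇ suc k then M else y) ≡ floor keep y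
  relabel {y} p with y ≡ᵇ suc k in e
  ... | true rewrite ≡ᵇ≡true⇒≡ y (suc k) e =
    sym (trans (floor-skip keep M (suc k) gap (m≤n⇒m≤1+n (maxLetter-lub π' k π'≤k))) (floor-fixed keep M (keep-π' (maxLetter-∈ 1 p₀))))
  ... | false = sym (floor-fixed keep y (trans (cong (_∧ not (y ≡ᵇ suc k)) (∈→mem y b (∈-++⁺ʳ π' p))) (cong not e)))

rSupport⇒ : ∀ x σ → rSupport x σ ≡ true → (σ ≡ lower (λ j → mem j σ) x) × (allB (λ j → mem j x) σ ≡ true)
rSupport⇒ x σ e with eqW σ (lower (λ j → mem j σ) x) in e1
... | true = eqW-true _ _ e1 , e

rSupport-length : ∀ x σ → rSupport x σ ≡ true → length σ ≡ length x
rSupport-length x σ e = trans (cong length (proj₁ (rSupport⇒ x σ e))) (length-map _ x)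

rCoeff-outside : ∀ x σ → rSupport x σ ≡ false → rCoeff x σ ≡ 0ℤ
rCoeff-outside x σ e rewrite e = refl

rSupport-1∉ : ∀ x σ → 1 ∈ x → All (1 ≤_) σ → mem 1 σ ≡ false → rSupport x σ ≡ false
rSupport-1∉ x σ 1∈x σ≥1 m1 with rSupport x σ in e
... | false = refl
... | true = ⊥-elim (<-irrefl refl (All.lookup σ≥1 (lower-0∈ x σ 1∈x (proj₁ (rSupport⇒ x σ e)) m1)))

rSupport-cong : ∀ x y σ → lower (λ j → mem j σ) x ≡ lower (λ j → mem j σ) y →
  allB (λ j → mem j x) σ ≡ allB (λ j → mem j y) σ → rSupport x σ ≡ rSupport y σ
rSupport-cong x y σ e a = cong₂ _∧_ (cong (eqW σ) e) a

-- If c ∈ σ, σ is not above the deletion of c from b; otherwise σ is above b exactly when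
-- it is above the deletion, and the deletion has one letter less missing from σ.
rCoeff-+-lowerExcept : ∀ b c σ → NDPF b → c ∈ b → c ≢ 1 → 1 ∈ b →
  rCoeff b σ +ℤ rCoeff (lower (lettersExcept b c) b) σ ≡ (if mem c σ then rCoeff b σ else 0ℤ)
rCoeff-+-lowerExcept b c σ n c∈ c≢1 1∈ = by-c∈σ (mem c σ) refl
  where
  keep = lettersExcept b c
  g : Admissible b keep
  g = lettersExcept-∈ b c 1∈ (c≢1 ∘ sym) , λ j e → mem→∈ j b (∧≡true⇒ˡ e)
  y = lower keep b
  y-letters : allB (λ j → mem j y) σ ≡ (allB (λ j → mem j b) σ ∧ not (mem c σ))
  y-letters = trans (allB-cong _ _ σ (λ {j} _ → mem-lower keep b n g j))
                (trans (allB-∧ (λ j → mem j b) (λ j → not (j ≡ᵇ c)) σ) (cong (allB (λ j → mem j b) σ ∧_) (allB-≢ c σ)))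
  by-c∈σ : ∀ m → mem c σ ≡ m → rCoeff b σ +ℤ rCoeff y σ ≡ (if m then rCoeff b σ else 0ℤ)
  by-c∈σ true e = trans (cong (rCoeff b σ +ℤ_) (rCoeff-outside y σ y-outside)) (ℤP.+-identityʳ _)
    where
    y-outside : rSupport y σ ≡ false
    y-outside rewrite y-letters | e | BP.∧-zeroʳ (allB (λ j → mem j b) σ) = BP.∧-zeroʳ _
  by-c∈σ false e = by-b-letters (allB (λ j → mem j b) σ) refl
    where
    by-b-letters : ∀ a → allB (λ j → mem j b) σ ≡ a → rCoeff b σ +ℤ rCoeff y σ ≡ 0ℤ
    by-b-letters false ea = cong₂ _+ℤ_ (rCoeff-outside b σ (trans (cong (eqW σ (lower (λ j → mem j σ) b) ∧_) ea) (BP.∧-zeroʳ _)))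
                                       (rCoeff-outside y σ (trans (cong (eqW σ (lower (λ j → mem j σ) y) ∧_) (trans y-letters (cong (_∧ not (mem c σ)) ea))) (BP.∧-zeroʳ _)))
    by-b-letters true ea = trans (cong (rCoeff b σ +ℤ_) rCoeff-y) (ℤP.+-inverseʳ (rCoeff b σ))
      where
      σ⊆keep : ∀ j → mem j σ ≡ true → keep j ≡ true
      σ⊆keep j h = lettersExcept-∈ b c (mem→∈ j b (allB-elim _ σ ea (mem→∈ j σ h)))
                     (λ { refl → true≢false (trans (sym h) e) })
      same-support : rSupport y σ ≡ rSupport b σ
      same-support = rSupport-cong y b σ (map-floor-lower keep (λ j → mem j σ) b σ⊆keep)
                       (trans y-letters (trans (cong₂ (λ p q → p ∧ not q) ea e) (sym ea)))
      c∉y : mem c y ≡ false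
      c∉y = trans (mem-lower keep b n g c) (lettersExcept-self b c)
      c∷y-Unique : Unique (c ∷ deduplicate _≟_ y)
      c∷y-Unique = All.tabulate (λ {j} p ce → true≢false (trans (sym (∈→mem c y (subst (_∈ y) (sym ce) (∈-deduplicate⁻ _≟_ y p)))) c∉y))
                   ∷ deduplicate-! y
      to : ∀ j → j ∈ b → j ∈ (c ∷ deduplicate _≟_ y)
      to j p with j ≟ c
      ... | yes refl = here refl
      ... | no ne = there (∈-deduplicate⁺ _≟_ (mem→∈ j y (trans (mem-lower keep b n g j) (lettersExcept-∈ b c p ne))))
      from : ∀ j → j ∈ (c ∷ deduplicate _≟_ y) → j ∈ deduplicate _≟_ b
      from j (here refl) = ∈-deduplicate⁺ _≟_ c∈
      from j (there p) = ∈-deduplicate⁺ _≟_ (proj₂ g j (trans (sym (mem-lower keep b n g j)) (∈→mem j y (∈-deduplicate⁻ _≟_ y p))))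
      sign-flip : rSign b σ ≡ - rSign y σ
      sign-flip = trans (altSign-filter-↭ (deduplicate _≟_ b) (c ∷ deduplicate _≟_ y) σ
                           (Unique-set-↭ _ _ (deduplicate-! b) c∷y-Unique (λ j p → to j (∈-deduplicate⁻ _≟_ b p)) from))
                    (c-dropped (deduplicate _≟_ y))
        where
        c-dropped : ∀ D → altSign (filterᵇ (notIn σ) (c ∷ D)) ≡ - altSign (filterᵇ (notIn σ) D)
        c-dropped D rewrite e = refl
      rCoeff-y : rCoeff y σ ≡ - rCoeff b σ
      rCoeff-y rewrite same-support with rSupport b σ
      ... | true = trans (sym (ℤP.neg-involutive (rSign y σ))) (cong -_ (sym sign-flip))
      ... | false = refl

if-∧-* : ∀ e1 e2 a1 a2 (s1 s2 : ℤ) → (if (e1 ∧ e2) ∧ (a1 ∧ a2) then s1 *ℤ s2 else 0ℤ) ≡ (if e1 ∧ a1 then s1 else 0ℤ) *ℤ (if e2 ∧ a2 then s2 else 0ℤ)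
if-∧-* true true true true s1 s2 = refl
if-∧-* true true true false s1 s2 = sym (ℤP.*-zeroʳ s1)
if-∧-* true true false a2 s1 s2 = refl
if-∧-* true false true true s1 s2 = sym (ℤP.*-zeroʳ s1)
if-∧-* true false true false s1 s2 = sym (ℤP.*-zeroʳ s1)
if-∧-* true false false a2 s1 s2 = refl
if-∧-* false e2 a1 a2 s1 s2 = refl

module _ (π' π'' σ1 σ2 : Word) (n' : NDPF π') (n'' : NDPF π'')
         (σ1≤ : All (_≤ length π') σ1) (σ2≥1 : All (1 ≤_) σ2) where

  private
    k = length π'
    σ = σ1 ++ shift k σ2
    b = π' • π''
    π'≤k = All.map proj₂ (NDPF-bounds π' n')
    π''≥1 = All.map proj₁ (NDPF-bounds π'' n'')
    ∈σ = λ j → mem j σ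
    ∈σ1 = λ j → mem j σ1
    ∈σ2 = λ j → mem j σ2

  mem-concat-low : ∀ j → j ≤ k → mem j σ ≡ mem j σ1
  mem-concat-low j le = trans (mem-++ j σ1 (shift k σ2)) (trans (cong (mem j σ1 ∨_) (mem-shift-below k j σ2 σ2≥1 le)) (BP.∨-identityʳ _))

  mem-concat-high : ∀ z → 1 ≤ z → mem (k + z) σ ≡ mem z σ2
  mem-concat-high z le = trans (mem-++ (k + z) σ1 (shift k σ2))
    (trans (cong (_∨ mem (k + z) (shift k σ2)) (mem-above k (k + z) σ1 σ1≤ (subst (_≤ k + z) (+-comm k 1) (+-monoʳ-≤ k le)))) (mem-shift k z σ2))

  mem-concat-boundary : mem (suc k) σ ≡ mem 1 σ2
  mem-concat-boundary = subst (λ q → mem q σ ≡ mem 1 σ2) (+-comm k 1) (mem-concat-high 1 ≤-refl)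

  floor-concat-high : mem 1 σ2 ≡ true → ∀ z' → floor ∈σ (k + suc z') ≡ k + floor ∈σ2 (suc z')
  floor-concat-high m1 z' = trans (cong (floor ∈σ) (+-suc k z')) (by-mem z' (mem (suc z') σ2) refl)
    where
    at : ∀ z' → mem (suc (k + z')) σ ≡ mem (suc z') σ2
    at z' = trans (cong ∈σ (sym (+-suc k z'))) (mem-concat-high (suc z') (s≤s z≤n))
    by-mem : ∀ z' c → mem (suc z') σ2 ≡ c → floor ∈σ (suc (k + z')) ≡ k + floor ∈σ2 (suc z')
    by-mem z' true ec = trans (cong (λ c → if c then suc (k + z') else floor ∈σ (k + z')) (trans (at z') ec))
      (trans (sym (+-suc k z')) (cong (λ c → k + (if c then suc z' else floor ∈σ2 z')) (sym ec)))
    by-mem zero false ec = ⊥-elim (true≢false (trans (sym m1) ec))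
    by-mem (suc z'') false ec = trans (cong (λ c → if c then suc (k + suc z'') else floor ∈σ (k + suc z'')) (trans (at (suc z'')) ec))
      (trans (floor-concat-high m1 z'') (cong (λ c → k + (if c then suc (suc z'') else floor ∈σ2 (suc z''))) (sym ec)))

  lower-concat : mem 1 σ2 ≡ true → lower ∈σ b ≡ lower ∈σ1 π' ++ shift k (lower ∈σ2 π'')
  lower-concat m1 = trans (map-++ (floor ∈σ) π' (shift k π''))
    (cong₂ _++_ (map-cong-local (All.tabulate (λ {y} p → floor-cong-≤ ∈σ ∈σ1 y (λ j jle → mem-concat-low j (≤-trans jle (All.lookup π'≤k p))))))
      (trans (sym (map-∘ π'')) (trans (map-cong-local (All.tabulate (λ {z} p → high z (All.lookup π''≥1 p)))) (map-∘ π''))))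
    where
    high : ∀ z → 1 ≤ z → floor ∈σ (k + z) ≡ k + floor ∈σ2 z
    high (suc z') _ = floor-concat-high m1 z'

  letters-concat : allB (λ j → mem j b) σ ≡ (allB (λ j → mem j π') σ1 ∧ allB (λ j → mem j π'') σ2)
  letters-concat = trans (allB-++ _ σ1 (shift k σ2)) (cong₂ _∧_
    (allB-cong _ _ σ1 (λ {j} p → trans (mem-++ j π' (shift k π''))
      (trans (cong (mem j π' ∨_) (mem-shift-below k j π'' π''≥1 (All.lookup σ1≤ p))) (BP.∨-identityʳ _))))
    (trans (allB-map _ (k +_) σ2) (allB-cong _ _ σ2 (λ {z} p → trans (mem-++ (k + z) π' (shift k π''))
       (trans (cong (_∨ mem (k + z) (shift k π'')) (mem-above k (k + z) π' π'≤k (subst (_≤ k + z) (+-comm k 1) (+-monoʳ-≤ k (All.lookup σ2≥1 p)))))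
         (mem-shift k z π''))))))

  rSupport-concat : mem 1 σ2 ≡ true → length σ1 ≡ k →
    rSupport b σ ≡ ((eqW σ1 (lower ∈σ1 π') ∧ eqW σ2 (lower ∈σ2 π'')) ∧ (allB (λ j → mem j π') σ1 ∧ allB (λ j → mem j π'') σ2))
  rSupport-concat m1 len = cong₂ _∧_ same-shape letters-concat
    where
    same-shape : eqW σ (lower ∈σ b) ≡ (eqW σ1 (lower ∈σ1 π') ∧ eqW σ2 (lower ∈σ2 π''))
    same-shape rewrite lower-concat m1 =
      trans (eqW-++ σ1 (shift k σ2) (lower ∈σ1 π') (shift k (lower ∈σ2 π'')) (trans len (sym (length-map _ π'))))
            (cong (eqW σ1 (lower ∈σ1 π') ∧_) (eqW-shift k σ2 (lower ∈σ2 π'')))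

  rSign-concat : rSign b σ ≡ rSign π' σ1 *ℤ rSign π'' σ2
  rSign-concat =
    trans (altSign-filter-↭ _ _ σ distinct) (trans (cong altSign (filter-++ (T? ∘ notIn σ) D1 (shift k D2)))
      (trans (cong altSign (cong₂ _++_ low (trans (filterᵇ-map (notIn σ) (k +_) D2) (cong (map (k +_)) high))))
      (trans (altSign-++ (filterᵇ (notIn σ1) D1) (map (k +_) (filterᵇ (notIn σ2) D2)))
             (cong (rSign π' σ1 *ℤ_) (altSign-map (k +_) (filterᵇ (notIn σ2) D2))))))
    where
    D1 = deduplicate _≟_ π'
    D2 = deduplicate _≟_ π''
    D1≤k : ∀ {j} → j ∈ D1 → j ≤ k
    D1≤k p = All.lookup π'≤k (∈-deduplicate⁻ _≟_ π' p)
    D2≥1 : ∀ {j} → j ∈ D2 → 1 ≤ j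
    D2≥1 p = All.lookup π''≥1 (∈-deduplicate⁻ _≟_ π'' p)
    disjoint-Unique : Unique (D1 ++ shift k D2)
    disjoint-Unique = UP.++⁺ (deduplicate-! π') (UP.map⁺ (λ {x} {y} e → +-cancelˡ-≡ k x y e) (deduplicate-! π''))
      (λ { (p , q) → <-irrefl refl (≤-<-trans (D1≤k p) (All.lookup (shift-ge k D2 (All.tabulate D2≥1)) q)) })
    to : ∀ j → j ∈ b → j ∈ D1 ++ shift k D2
    to j p with ∈-++⁻ π' p
    ... | inj₁ q = ∈-++⁺ˡ (∈-deduplicate⁺ _≟_ q)
    ... | inj₂ q with ∈-map⁻ (k +_) q
    ... | z , z∈ , refl = ∈-++⁺ʳ D1 (∈-map⁺ (k +_) (∈-deduplicate⁺ _≟_ z∈))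
    from : ∀ j → j ∈ D1 ++ shift k D2 → j ∈ b
    from j p with ∈-++⁻ D1 p
    ... | inj₁ q = ∈-++⁺ˡ (∈-deduplicate⁻ _≟_ π' q)
    ... | inj₂ q with ∈-map⁻ (k +_) q
    ... | z , z∈ , refl = ∈-++⁺ʳ π' (∈-map⁺ (k +_) (∈-deduplicate⁻ _≟_ π'' z∈))
    distinct : deduplicate _≟_ b ↭ D1 ++ shift k D2
    distinct = Unique-set-↭ _ _ (deduplicate-! b) disjoint-Unique
                 (λ j p → to j (∈-deduplicate⁻ _≟_ b p)) (λ j p → ∈-deduplicate⁺ _≟_ (from j p))
    low : filterᵇ (notIn σ) D1 ≡ filterᵇ (notIn σ1) D1
    low = filterᵇ-cong _ _ D1 (λ {j} p → cong not (mem-concat-low j (D1≤k p)))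
    high : filterᵇ (notIn σ ∘ (k +_)) D2 ≡ filterᵇ (notIn σ2) D2
    high = filterᵇ-cong _ _ D2 (λ {z} p → cong not (mem-concat-high z (D2≥1 p)))

  -- σ is above π' • π'' and contains |π'| + 1 exactly when its two halves are above π'
  -- and π''; signs multiply because the letter sets are disjoint.
  rCoeff-• : 1 ∈ π'' → length σ1 ≡ k →
    (if mem (suc k) σ then rCoeff b σ else 0ℤ) ≡ rCoeff π' σ1 *ℤ rCoeff π'' σ2
  rCoeff-• 1∈π'' len rewrite mem-concat-boundary with mem 1 σ2 in m1
  ... | false rewrite rCoeff-outside π'' σ2 (rSupport-1∉ π'' σ2 1∈π'' σ2≥1 m1) = sym (ℤP.*-zeroʳ (rCoeff π' σ1))
  ... | true rewrite rSupport-concat m1 len | rSign-concat =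
    if-∧-* (eqW σ1 (lower ∈σ1 π')) (eqW σ2 (lower ∈σ2 π'')) (allB (λ j → mem j π') σ1) (allB (λ j → mem j π'') σ2) (rSign π' σ1) (rSign π'' σ2)

-- The product rule

module _ (R : Word → PQ) (hyp : ∀ π → NDPF π → ∀ a → P π a ≡ sumUp R π a)
         (p₀ q₀ : Word) (n' : NDPF (1 ∷ p₀)) (n'' : NDPF (1 ∷ q₀)) (a : Word) where

  private
    π' = 1 ∷ p₀
    π'' = 1 ∷ q₀
    k = length π'
    b = π' • π''
    σ = sort a
    f' = λ u → rCoeff π' (sort u)
    g' = λ v → rCoeff π'' (sort v)
    low : ℕ → Bool
    low x = x ≤ᵇ k
    U = filterᵇ low a
    V = filterᵇ (λ x → not (low x)) a
    π'≤k = All.map proj₂ (NDPF-bounds π' n')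
    π''≥1 = All.map proj₁ (NDPF-bounds π'' n'')

  R•+R▷ : R b a +ℤ R (π' ▷ π'') a ≡ (if mem (suc k) σ then rCoeff b σ else 0ℤ)
  R•+R▷ = trans (cong₂ _+ℤ_ (R≡rCoeff R hyp (p₀ ++ shift k π'') b-NDPF a) (R≡rCoeff R hyp _ ▷-NDPF a))
            (trans (cong (λ q → rCoeff b σ +ℤ rCoeff q σ) ▷≡) (rCoeff-+-lowerExcept b (suc k) σ b-NDPF sk∈b (λ ()) (here refl)))
    where
    b-NDPF : NDPF b
    b-NDPF = NDPF-• π' π'' n' n''
    ▷≡ : π' ▷ π'' ≡ lower (lettersExcept b (suc k)) b
    ▷≡ = ▷-as-lowering p₀ π'' n' n''
    sk∈b : suc k ∈ b
    sk∈b = ∈-++⁺ʳ π' (here (sym (+-comm k 1)))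
    ▷-NDPF : NDPF (π' ▷ π'')
    ▷-NDPF = subst NDPF (sym ▷≡) (NDPF-lower _ b (cong not (≢⇒≡ᵇ≡false 1 (suc k) (λ ()))) b-NDPF)

  left-factor-support : ∀ u → rSupport π' (sort u) ≡ true → length u ≡ k × allB low u ≡ true
  left-factor-support u e =
    trans (sym (length-sort u)) (rSupport-length π' (sort u) e) ,
    allB-intro low u (λ {x} q → T⇒≡true (≤⇒≤ᵇ (All.lookup π'≤k (mem→∈ x π' (allB-elim _ (sort u) (proj₂ (rSupport⇒ π' (sort u) e)) (∈-sort⁺ u q))))))

  split-vanishes : ∀ u v → (allB low u ∧ allB (λ x → not (low x)) v) ≡ false → splitTerm f' g' (u , v) ≡ 0ℤ
  split-vanishes u v c with rSupport π' (sort u) in e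
  ... | false with allB (λ x → length u <ᵇ x) v
  ... | true = refl
  ... | false = refl
  split-vanishes u v c | true rewrite proj₁ (left-factor-support u e) | proj₂ (left-factor-support u e)
     | allB-cong (k <ᵇ_) (λ x → not (low x)) v (λ {x} _ → sym (not-≤ᵇ x k)) | c = refl

  low-part-length : mem (suc k) σ ≡ true → rSupport b σ ≡ true → length U ≡ k
  low-part-length sk∈σ e = trans (sym (PP.↭-length (PP.filter-↭ (T? ∘ low) (sort-↭ a)))) low-σ
    where
    ∈σ = λ j → mem j σ
    low-σ : length (filterᵇ low σ) ≡ k
    low-σ = begin
        length (filterᵇ low σ)
      ≡⟨ cong (λ w → length (filterᵇ low w)) (trans (proj₁ (rSupport⇒ b σ e)) (map-++ (floor ∈σ) π' (shift k π''))) ⟩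
        length (filterᵇ low (lower ∈σ π' ++ lower ∈σ (shift k π'')))
      ≡⟨ cong length (filter-++ (T? ∘ low) (lower ∈σ π') (lower ∈σ (shift k π''))) ⟩
        length (filterᵇ low (lower ∈σ π') ++ filterᵇ low (lower ∈σ (shift k π'')))
      ≡⟨ cong₂ (λ x y → length (x ++ y)) (filterᵇ-all low (lower ∈σ π') (All.tabulate stays-low))
                                          (filterᵇ-none low (lower ∈σ (shift k π'')) (All.tabulate stays-high)) ⟩
        length (lower ∈σ π' ++ [])
      ≡⟨ trans (cong length (++-identityʳ (lower ∈σ π'))) (length-map (floor ∈σ) π') ⟩
        k
      ∎
      where
      open ≡-Reasoning
      stays-low : ∀ {y} → y ∈ lower ∈σ π' → low y ≡ true
      stays-low q with ∈-map⁻ (floor ∈σ) q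
      ... | x , x∈ , refl = T⇒≡true (≤⇒≤ᵇ (≤-trans (floor-≤ ∈σ x) (All.lookup π'≤k x∈)))
      stays-high : ∀ {y} → y ∈ lower ∈σ (shift k π'') → low y ≡ false
      stays-high q with ∈-map⁻ (floor ∈σ) q
      ... | x , x∈ , refl = ¬T⇒≡false (λ t → <⇒≱ (floor-≥ ∈σ (suc k) x sk∈σ (All.lookup (shift-ge k π'' π''≥1) x∈)) (≤ᵇ⇒≤ _ k t))

  split-wrong-length : length U ≢ k → splitTerm f' g' (U , V) ≡ (if mem (suc k) σ then rCoeff b σ else 0ℤ)
  split-wrong-length ne = trans left-zero (sym right-zero)
    where
    f'U≡0 : f' U ≡ 0ℤ
    f'U≡0 with rSupport π' (sort U) in e
    ... | false = refl
    ... | true = ⊥-elim (ne (proj₁ (left-factor-support U e)))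
    left-zero : splitTerm f' g' (U , V) ≡ 0ℤ
    left-zero with allB (λ x → length U <ᵇ x) V
    ... | false = refl
    ... | true = cong (_*ℤ g' (map (λ x → x ∸ length U) V)) f'U≡0
    right-zero : (if mem (suc k) σ then rCoeff b σ else 0ℤ) ≡ 0ℤ
    right-zero with mem (suc k) σ in sk∈σ
    ... | false = refl
    ... | true with rSupport b σ in e
    ... | false = refl
    ... | true = ⊥-elim (ne (low-part-length sk∈σ e))

  split-right-length : length U ≡ k → splitTerm f' g' (U , V) ≡ (if mem (suc k) σ then rCoeff b σ else 0ℤ)
  split-right-length lenU =
    trans (cong (λ c → if c then f' U *ℤ g' (map (λ x → x ∸ length U) V) else 0ℤ) V-high)
      (trans (cong (λ m → f' U *ℤ g' (map (λ x → x ∸ m) V)) lenU)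
        (trans (sym (rCoeff-• π' π'' σ1 σ2 n' n'' σ1≤k σ2≥1 (here refl) (trans (length-sort U) lenU)))
          (cong (λ s → if mem (suc k) s then rCoeff b s else 0ℤ) (sym σ≡))))
    where
    V' = map (λ x → x ∸ k) V
    σ1 = sort U
    σ2 = sort V'
    V>k : ∀ {x} → x ∈ V → k < x
    V>k {x} q = <ᵇ⇒< k x (≡true⇒T (trans (sym (not-≤ᵇ x k)) (filterᵇ-mem (λ x → not (low x)) a q)))
    V-high : allB (λ x → length U <ᵇ x) V ≡ true
    V-high rewrite lenU = allB-intro _ V (λ q → T⇒≡true (<⇒<ᵇ (V>k q)))
    σ1≤k : All (_≤ k) σ1
    σ1≤k = All.tabulate (λ q → ≤ᵇ⇒≤ _ k (≡true⇒T (filterᵇ-mem low a (∈-sort⁻ U q))))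
    σ2≥1 : All (1 ≤_) σ2
    σ2≥1 = All.tabulate (λ {y} q → positive (∈-sort⁻ V' q))
      where
      positive : ∀ {y} → y ∈ V' → 1 ≤ y
      positive q with ∈-map⁻ (λ x → x ∸ k) q
      ... | x , x∈ , refl = m<n⇒0<n∸m (V>k x∈)
    V≡ : V ≡ shift k V'
    V≡ = sym (trans (sym (map-∘ V)) (map-id-local (All.tabulate (λ q → m+[n∸m]≡n (<⇒≤ (V>k q))))))
    σ↭ : a ↭ σ1 ++ shift k σ2
    σ↭ = ↭-trans (partition-↭ low a) (PP.++⁺ (↭-sym (sort-↭ U)) (subst (_↭ shift k σ2) (sym V≡) (PP.map⁺ (k +_) (↭-sym (sort-↭ V')))))
    sorted : Linked _≤_ (σ1 ++ shift k σ2)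
    sorted = linked-++ σ1 (shift k σ2) (sort-↗ U) (linked-map (k +_) σ2 (λ x y → +-monoʳ-≤ k) (sort-↗ V'))
               (λ q r → ≤-trans (All.lookup σ1≤k q) (≤-trans (n≤1+n k) (All.lookup (shift-ge k σ2 σ2≥1) r)))
    σ≡ : σ ≡ σ1 ++ shift k σ2
    σ≡ = sort-unique a _ sorted σ↭

  single-split : splitTerm f' g' (U , V) ≡ (if mem (suc k) σ then rCoeff b σ else 0ℤ)
  single-split with length U ≟ k
  ... | yes e = split-right-length e
  ... | no ne = split-wrong-length ne

  product-rule : (R π' ⊛ R π'') a ≡ R b a +ℤ R (π' ▷ π'') a
  product-rule =
    begin
      sumℤ (map (splitTerm (R π') (R π'')) (splits a))
    ≡⟨ sumℤ-cong _ (splitTerm f' g') (splits a) (λ { {u , v} _ → cong (λ z → if allB (λ x → length u <ᵇ x) v then z else 0ℤ)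
                                                  (cong₂ _*ℤ_ (R≡rCoeff R hyp p₀ n' u) (R≡rCoeff R hyp q₀ n'' _)) }) ⟩
      sumℤ (map (splitTerm f' g') (splits a))
    ≡⟨ sum-splits-single low a (splitTerm f' g') split-vanishes ⟩
      splitTerm f' g' (U , V)
    ≡⟨ single-split ⟩
      (if mem (suc k) σ then rCoeff b σ else 0ℤ)
    ≡⟨ sym R•+R▷ ⟩
      R b a +ℤ R (π' ▷ π'') a
    ∎
    where open ≡-Reasoning

mainTheorem17 : (R : Word → PQ)
    → (∀ π → NDPF π → ∀ a → P π a ≡ sumUp R π a)
    → ∀ π′ π″ → NDPF π′ → NDPF π″ → π′ ≢ [] → π″ ≢ []
    → ∀ a → (R π′ ⊛ R π″) a ≡ R (π′ • π″) a +ℤ R (π′ ▷ π″) a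
mainTheorem17 R hyp [] π″ n′ n″ ne′ ne″ a = ⊥-elim (ne′ refl)
mainTheorem17 R hyp (x ∷ p₀) [] n′ n″ ne′ ne″ a = ⊥-elim (ne″ refl)
mainTheorem17 R hyp (x ∷ p₀) (y ∷ q₀) n′ n″ ne′ ne″ a with NDPF-head x p₀ n′ | NDPF-head y q₀ n″
... | refl | refl = product-rule R hyp p₀ q₀ n′ n″ a
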